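{- For every integer $n\geq 3$ there is a constant $C_n>0$ such that $$t^n\;\leq\;|\mathcal{R}_n(t)|\;\leq\;C_n\, t^n$$ for all real $t\geq 1$.
   Context: For a polynomial $p(X)=a_nX^n+\cdots+a_1X+a_0\in\mathbb{Z}[X]$ its height is $H(p)=\max\{|a_i| : i=0,1,\dots,n\}$. For an integer $n\geq 2$ and real $t\geq 1$, $\mathcal{R}_n(t)$ denotes the set of all polynomials $p(X)\in\mathbb{Z}[X]$ of degree exactly $n$ (i.e. $a_n\neq 0$) with $H(p)\leq t$ which are reducible in $\mathbb{Q}[X]$ (equivalently, $p$ is a product of two polynomials in $\mathbb{Z}[X]$ each of degree less than $n$).
   Formalization: The parameter t ranges only over rationals t ≥ 1 instead of real t ≥ 1, and the constant $C_n$ is taken to be rational. -}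

module Defs where

open import Data.Nat as ℕ using (ℕ; zero; suc; _∸_)
open import Data.Integer as ℤ using (ℤ; +_)
open import Data.Rational as ℚ using (ℚ; 1ℚ; _/_)
open import Data.Fin using (Fin; fromℕ)
open import Data.Vec using (Vec; lookup; toList)
open import Data.List using (List; []; _∷_)
open import Data.Product using (Σ; ∃; _×_)
open import Relation.Binary.PropositionalEquality using (_≡_; _≢_)

_^ℚ_ : ℚ → ℕ → ℚ
q ^ℚ zero  = 1ℚ
q ^ℚ suc k = q ℚ.* (q ^ℚ k)

ℕ→ℚ : ℕ → ℚ
ℕ→ℚ k = + k / 1

-- a polynomial given by a coefficient list [a₀, a₁, …]; coefficient of X^i
coeff : List ℤ → ℕ → ℤ
coeff []       _       = + 0
coeff (a ∷ as) zero    = a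
coeff (a ∷ as) (suc i) = coeff as i

sumTo : ℕ → (ℕ → ℤ) → ℤ
sumTo zero    f = f zero
sumTo (suc k) f = sumTo k f ℤ.+ f (suc k)

mulCoeff : List ℤ → List ℤ → ℕ → ℤ
mulCoeff q r k = sumTo k (λ i → coeff q i ℤ.* coeff r (k ∸ i))

-- A polynomial of degree ≤ n is represented by Vec ℤ (suc n) = (a₀, …, aₙ).
-- Reducible: p = q * r with q, r ∈ ℤ[X] each of degree < n
-- (i.e. each given by n coefficients a₀ … a_{n-1}).
Reducible : (n : ℕ) → Vec ℤ (suc n) → Set
Reducible n p = Σ (Vec ℤ n) λ q → Σ (Vec ℤ n) λ r →
  (k : ℕ) → mulCoeff (toList q) (toList r) k ≡ coeff (toList p) k

HeightLE : {n : ℕ} → Vec ℤ (suc n) → ℚ → Set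
HeightLE {n} p t = (i : Fin (suc n)) → (+ ℤ.∣ lookup p i ∣) / 1 ℚ.≤ t

-- membership in 𝓡ₙ(t): degree exactly n, height ≤ t, reducible
InR : (n : ℕ) → ℚ → Vec ℤ (suc n) → Set
InR n t p = (lookup p (fromℕ n) ≢ + 0) × HeightLE p t × Reducible n p

{-# OPTIONS --safe #-}
module Submission where

-- Write T = ⌊t⌋, so that heights at most t are exactly heights at most T.
--
-- Lower bound: the polynomials X·w(X) with w of degree n − 1, leading coefficient in [1, T]
-- and all other coefficients in [−T, T] are T(2T + 1)ⁿ⁻¹ ≥ (T + 1)ⁿ > tⁿ distinct elements
-- of 𝓡ₙ(t).
--
-- Upper bound: every p ∈ 𝓡ₙ(T) is encoded injectively by one of O(Tⁿ) codes.  If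
-- p = (c₀ + c₁X)·g, because a factor has degree at most 1 or p has a root in {0, …, n},
-- comparing coefficients from the bottom (when |c₁| ≤ |c₀|) or from the top gives
-- s·|g_k| ≤ nT for s = max(|c₀|, |c₁|); the codes (c₀, c₁, g) then number
-- Σ_{s ≤ nT} O(s)·(3nT/s)ⁿ = O(Tⁿ), since n ≥ 3.  Otherwise p = q·r with both degrees at
-- least 2 and p(x) ≠ 0 for x = 0, …, n; then q and r are determined by their values at
-- 0, …, deg, which are bounded by |p(x)| ≤ T(n + 1)ⁿ⁺¹ ≤ K³ for some K with
-- K³ ≤ 8T(n + 1)ⁿ⁺¹.  At x = 0, 1, 2 the bound |q(x) r(x)| ≤ K³ leaves only 27K⁴
-- possibilities for the pair (q(x), r(x)), so the n + 2 values are encoded in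
-- (27K⁴)³(3K³)ⁿ⁻⁴ = O(K³ⁿ) = O(Tⁿ) ways.

open import Defs
open import Data.Nat as ℕ using (ℕ; zero; suc; z≤n; s≤s; _≤_; _<_; _∸_; _⊔_)
import Data.Nat.Properties as ℕₚ
open import Data.Integer as ℤ using (ℤ; +_; -[1+_]; 0ℤ; 1ℤ; ∣_∣; _⊖_)
import Data.Integer.Properties as ℤₚ
open import Data.Rational as ℚ using (ℚ; 0ℚ; 1ℚ) renaming (_≤_ to _≤ℚ_; _<_ to _<ℚ_)
import Data.Rational.Properties as ℚₚ
open import Data.List as List using (List; []; _∷_; length; applyUpTo)
import Data.List.Properties as Listₚ
open import Data.Vec as Vec using (Vec; []; _∷_; toList; lookup)
import Data.Vec.Properties as Vecₚ
open import Data.Fin as Fin using (Fin; zero; suc; toℕ; fromℕ)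
import Data.Fin.Properties as Finₚ
open import Data.Product using (Σ; ∃; ∃₂; _×_; _,_; proj₁; proj₂; uncurry)
open import Data.Sum using (_⊎_; inj₁; inj₂)
open import Data.Empty using (⊥; ⊥-elim)
open import Function using (_∘_)
open import Function.Definitions using (Injective)
open import Relation.Unary using (_∪_; _⊆_; _⟨×⟩_; _⟨⊎⟩_)
open import Relation.Nullary using (yes; no)
open import Relation.Binary.PropositionalEquality
open import Algebra.Properties.AbelianGroup ℤₚ.+-0-abelianGroup using () renaming (∙-cancelʳ to +-cancelʳ)

module Rationals where

  open import Data.Nat.DivMod using (_/_; m≡m%n+[m/n]*n; m%n<n; m*n/n≡m; /-monoˡ-≤; m/n*n≤m)
  import Data.Nat.Coprimality as Coprimality
  open import Data.Integer using (+≤+)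
  open import Data.Rational using (mkℚ; ↥_; ↧ₙ_; *≤*; *<*)

  ℕ→ℚ≡mkℚ : ∀ k → ℕ→ℚ k ≡ mkℚ (+ k) 0 (Coprimality.sym (Coprimality.1-coprimeTo k))
  ℕ→ℚ≡mkℚ k = ℚₚ.↥p/↧p≡p (mkℚ (+ k) 0 _)

  ℕ→ℚ-*-homo : ∀ m n → ℕ→ℚ (m ℕ.* n) ≡ ℕ→ℚ m ℚ.* ℕ→ℚ n
  ℕ→ℚ-*-homo m n = begin
    + (m ℕ.* n) ℚ./ 1                       ≡⟨ cong (ℚ._/ 1) (ℤₚ.pos-* m n) ⟩
    (+ m ℤ.* + n) ℚ./ 1                     ≡⟨ cong₂ ℚ._*_ (sym (ℕ→ℚ≡mkℚ m)) (sym (ℕ→ℚ≡mkℚ n)) ⟩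
    ℕ→ℚ m ℚ.* ℕ→ℚ n                         ∎
    where open ≡-Reasoning

  ℕ→ℚ-^-homo : ∀ m n → ℕ→ℚ (m ℕ.^ n) ≡ ℕ→ℚ m ^ℚ n
  ℕ→ℚ-^-homo m zero    = refl
  ℕ→ℚ-^-homo m (suc n) = trans (ℕ→ℚ-*-homo m (m ℕ.^ n)) (cong (ℕ→ℚ m ℚ.*_) (ℕ→ℚ-^-homo m n))

  ℕ→ℚ-mono-≤ : ∀ {m n} → m ℕ.≤ n → ℕ→ℚ m ≤ℚ ℕ→ℚ n
  ℕ→ℚ-mono-≤ {m} {n} m≤n rewrite ℕ→ℚ≡mkℚ m | ℕ→ℚ≡mkℚ n = *≤* (ℤₚ.*-monoʳ-≤-nonNeg (+ 1) (+≤+ m≤n))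

  ℕ→ℚ-nonNeg : ∀ n → 0ℚ ≤ℚ ℕ→ℚ n
  ℕ→ℚ-nonNeg n = ℕ→ℚ-mono-≤ {0} {n} z≤n

  ℕ→ℚ-pos : ∀ n .{{_ : ℕ.NonZero n}} → 0ℚ <ℚ ℕ→ℚ n
  ℕ→ℚ-pos (suc n) rewrite ℕ→ℚ≡mkℚ (suc n) = *<* (ℤ.+<+ (s≤s z≤n))

  ^ℚ-nonNeg : ∀ {p} n → 0ℚ ≤ℚ p → 0ℚ ≤ℚ p ^ℚ n
  ^ℚ-nonNeg zero    0≤p = ℕ→ℚ-nonNeg 1
  ^ℚ-nonNeg {p} (suc n) 0≤p = ℚₚ.nonNegative⁻¹ _
    {{ℚₚ.nonNeg*nonNeg⇒nonNeg p {{ℚ.nonNegative 0≤p}} (p ^ℚ n) {{ℚ.nonNegative (^ℚ-nonNeg n 0≤p)}}}}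

  ^ℚ-monoˡ-≤ : ∀ {p q} n → 0ℚ ≤ℚ p → p ≤ℚ q → p ^ℚ n ≤ℚ q ^ℚ n
  ^ℚ-monoˡ-≤ zero 0≤p p≤q = ℚₚ.≤-refl
  ^ℚ-monoˡ-≤ {p} {q} (suc n) 0≤p p≤q = ℚₚ.≤-trans
    (ℚₚ.*-monoˡ-≤-nonNeg p {{ℚ.nonNegative 0≤p}} (^ℚ-monoˡ-≤ n 0≤p p≤q))
    (ℚₚ.*-monoʳ-≤-nonNeg (q ^ℚ n) {{ℚ.nonNegative (^ℚ-nonNeg n (ℚₚ.≤-trans 0≤p p≤q))}} p≤q)

  -- ⌊ t ⌋ when t ≥ 0; for negative t this is not the floor.
  floorℕ : ℚ → ℕ
  floorℕ t = ∣ ↥ t ∣ / ↧ₙ t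

  private
    module _ (k : ℕ) {N d : ℕ} .{c : Coprimality.Coprime N (suc d)} where

      ℕ→ℚ≤mkℚ⁺ : k ℕ.* suc d ℕ.≤ N → ℕ→ℚ k ≤ℚ mkℚ (+ N) d c
      ℕ→ℚ≤mkℚ⁺ le rewrite ℕ→ℚ≡mkℚ k =
        *≤* (subst₂ ℤ._≤_ (ℤₚ.pos-* k (suc d)) (sym (ℤₚ.*-identityʳ (+ N))) (+≤+ le))

      ℕ→ℚ≤mkℚ⁻ : ℕ→ℚ k ≤ℚ mkℚ (+ N) d c → k ℕ.* suc d ℕ.≤ N
      ℕ→ℚ≤mkℚ⁻ le rewrite ℕ→ℚ≡mkℚ k with le
      ... | *≤* le′ = ℤₚ.drop‿+≤+ (subst₂ ℤ._≤_ (sym (ℤₚ.pos-* k (suc d))) (ℤₚ.*-identityʳ (+ N)) le′)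

      mkℚ≤ℕ→ℚ⁺ : N ℕ.≤ k ℕ.* suc d → mkℚ (+ N) d c ≤ℚ ℕ→ℚ k
      mkℚ≤ℕ→ℚ⁺ le rewrite ℕ→ℚ≡mkℚ k =
        *≤* (subst₂ ℤ._≤_ (sym (ℤₚ.*-identityʳ (+ N))) (ℤₚ.pos-* k (suc d)) (+≤+ le))

  ℕ→ℚ≤⇒≤floorℕ : ∀ {k t} → ℕ→ℚ k ≤ℚ t → k ℕ.≤ floorℕ t
  ℕ→ℚ≤⇒≤floorℕ {k} {mkℚ (+ N) d _} k≤t = begin
    k                      ≡⟨ m*n/n≡m k (suc d) ⟨
    k ℕ.* suc d / suc d    ≤⟨ /-monoˡ-≤ (suc d) (ℕ→ℚ≤mkℚ⁻ k k≤t) ⟩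
    N / suc d              ∎
    where open ℕₚ.≤-Reasoning
  ℕ→ℚ≤⇒≤floorℕ {k} {mkℚ -[1+ N ] d _} k≤t with ℚₚ.≤-trans (ℕ→ℚ-nonNeg k) k≤t
  ... | *≤* ()

  ≤floorℕ⇒ℕ→ℚ≤ : ∀ {k t} → 0ℚ ≤ℚ t → k ℕ.≤ floorℕ t → ℕ→ℚ k ≤ℚ t
  ≤floorℕ⇒ℕ→ℚ≤ {k} {mkℚ (+ N) d _} _ k≤⌊t⌋ =
    ℕ→ℚ≤mkℚ⁺ k (ℕₚ.≤-trans (ℕₚ.*-monoˡ-≤ (suc d) k≤⌊t⌋) (m/n*n≤m N (suc d)))
  ≤floorℕ⇒ℕ→ℚ≤ {t = mkℚ -[1+ N ] d _} (*≤* ()) _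

  ≤ℕ→ℚ[1+floorℕ] : ∀ {t} → 0ℚ ≤ℚ t → t ≤ℚ ℕ→ℚ (suc (floorℕ t))
  ≤ℕ→ℚ[1+floorℕ] {mkℚ (+ N) d _} _ = mkℚ≤ℕ→ℚ⁺ (suc (N / suc d)) (begin
    N                                          ≡⟨ m≡m%n+[m/n]*n N (suc d) ⟩
    N ℕ.% suc d ℕ.+ N / suc d ℕ.* suc d        ≤⟨ ℕₚ.+-monoˡ-≤ _ (ℕₚ.<⇒≤ (m%n<n N (suc d))) ⟩
    suc (N / suc d) ℕ.* suc d                  ∎)
    where open ℕₚ.≤-Reasoning
  ≤ℕ→ℚ[1+floorℕ] {mkℚ -[1+ N ] d _} (*≤* ())

  InRℕ : (n T : ℕ) → Vec ℤ (suc n) → Set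
  InRℕ n T p = (lookup p (fromℕ n) ≢ + 0) × (∀ i → ∣ lookup p i ∣ ℕ.≤ T) × Reducible n p

  InR⇒InRℕ : ∀ {n t} p → InR n t p → InRℕ n (floorℕ t) p
  InR⇒InRℕ p (lead , height , red) = lead , (λ i → ℕ→ℚ≤⇒≤floorℕ (height i)) , red

  InRℕ⇒InR : ∀ {n t} p → 0ℚ ≤ℚ t → InRℕ n (floorℕ t) p → InR n t p
  InRℕ⇒InR p 0≤t (lead , height , red) = lead , (λ i → ≤floorℕ⇒ℕ→ℚ≤ 0≤t (height i)) , red

  ^ℚ≤ℕ→ℚ : ∀ {t k} n → 0ℚ ≤ℚ t → suc (floorℕ t) ℕ.^ n ℕ.≤ k → t ^ℚ n ≤ℚ ℕ→ℚ k
  ^ℚ≤ℕ→ℚ {t} {k} n 0≤t count = ℚₚ.≤-trans (^ℚ-monoˡ-≤ n 0≤t (≤ℕ→ℚ[1+floorℕ] 0≤t))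
    (subst (_≤ℚ ℕ→ℚ k) (ℕ→ℚ-^-homo (suc (floorℕ t)) n) (ℕ→ℚ-mono-≤ count))

  ℕ→ℚ≤*^ℚ : ∀ {t m} C n → 0ℚ ≤ℚ t → m ℕ.≤ floorℕ t ℕ.^ n ℕ.* C → ℕ→ℚ m ≤ℚ ℕ→ℚ C ℚ.* t ^ℚ n
  ℕ→ℚ≤*^ℚ {t} {m} C n 0≤t count = ℚₚ.≤-trans (ℕ→ℚ-mono-≤ count) (begin
    ℕ→ℚ (floorℕ t ℕ.^ n ℕ.* C)             ≡⟨ cong ℕ→ℚ (ℕₚ.*-comm (floorℕ t ℕ.^ n) C) ⟩
    ℕ→ℚ (C ℕ.* floorℕ t ℕ.^ n)             ≡⟨ ℕ→ℚ-*-homo C _ ⟩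
    ℕ→ℚ C ℚ.* ℕ→ℚ (floorℕ t ℕ.^ n)         ≡⟨ cong (ℕ→ℚ C ℚ.*_) (ℕ→ℚ-^-homo (floorℕ t) n) ⟩
    ℕ→ℚ C ℚ.* ℕ→ℚ (floorℕ t) ^ℚ n          ≤⟨ ℚₚ.*-monoˡ-≤-nonNeg (ℕ→ℚ C) {{ℚ.nonNegative (ℕ→ℚ-nonNeg C)}}
                                                (^ℚ-monoˡ-≤ n (ℕ→ℚ-nonNeg (floorℕ t)) (≤floorℕ⇒ℕ→ℚ≤ {floorℕ t} 0≤t ℕₚ.≤-refl)) ⟩
    ℕ→ℚ C ℚ.* t ^ℚ n                       ∎)
    where open ℚₚ.≤-Reasoning

open Rationals

module Polynomials where

  open import Data.Integer using (_+_; _*_; -_; _-_)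
  open import Data.Integer.Tactic.RingSolver using (solve-∀)
  open import Data.List using (map)

  sumTo-cong : ∀ k {f g : ℕ → ℤ} → (∀ i → i ≤ k → f i ≡ g i) → sumTo k f ≡ sumTo k g
  sumTo-cong zero    f≗g = f≗g 0 z≤n
  sumTo-cong (suc k) f≗g =
    cong₂ _+_ (sumTo-cong k (λ i i≤k → f≗g i (ℕₚ.m≤n⇒m≤1+n i≤k))) (f≗g (suc k) ℕₚ.≤-refl)

  sumTo-zero : ∀ k {f : ℕ → ℤ} → (∀ i → i ≤ k → f i ≡ 0ℤ) → sumTo k f ≡ 0ℤ
  sumTo-zero zero    f≡0 = f≡0 0 z≤n
  sumTo-zero (suc k) f≡0 = cong₂ _+_ (sumTo-zero k (λ i i≤k → f≡0 i (ℕₚ.m≤n⇒m≤1+n i≤k))) (f≡0 (suc k) ℕₚ.≤-refl)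

  sumTo-single : ∀ k {a} {f : ℕ → ℤ} → a ≤ k → (∀ i → i ≤ k → i ≢ a → f i ≡ 0ℤ) → sumTo k f ≡ f a
  sumTo-single zero    z≤n _ = refl
  sumTo-single (suc k) {a} {f} a≤1+k others with a ℕ.≟ suc k
  ... | yes refl = trans (cong (_+ f (suc k)) (sumTo-zero k (λ i i≤k → others i (ℕₚ.m≤n⇒m≤1+n i≤k) (ℕₚ.<⇒≢ (s≤s i≤k)))))
                         (ℤₚ.+-identityˡ (f (suc k)))
  ... | no a≢1+k = trans (cong₂ _+_ (sumTo-single k (ℕₚ.≤-pred (ℕₚ.≤∧≢⇒< a≤1+k a≢1+k))
                                      (λ i i≤k → others i (ℕₚ.m≤n⇒m≤1+n i≤k)))
                                    (others (suc k) ℕₚ.≤-refl (a≢1+k ∘ sym)))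
                         (ℤₚ.+-identityʳ (f a))

  sumTo-shift : ∀ k (f : ℕ → ℤ) → sumTo (suc k) f ≡ f 0 + sumTo k (f ∘ suc)
  sumTo-shift zero    f = refl
  sumTo-shift (suc k) f = trans (cong (_+ f (suc (suc k))) (sumTo-shift k f))
                                (ℤₚ.+-assoc (f 0) (sumTo k (f ∘ suc)) (f (suc (suc k))))

  sumTo-reverse : ∀ k (f : ℕ → ℤ) → sumTo k (λ i → f (k ∸ i)) ≡ sumTo k f
  sumTo-reverse zero    f = refl
  sumTo-reverse (suc k) f = begin
    sumTo (suc k) (λ i → f (suc k ∸ i))   ≡⟨ sumTo-shift k (λ i → f (suc k ∸ i)) ⟩
    f (suc k) + sumTo k (λ i → f (k ∸ i)) ≡⟨ cong (_+_ (f (suc k))) (sumTo-reverse k f) ⟩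
    f (suc k) + sumTo k f                 ≡⟨ ℤₚ.+-comm (f (suc k)) (sumTo k f) ⟩
    sumTo (suc k) f                       ∎
    where open ≡-Reasoning

  -- Equality of polynomials: the coefficient lists may differ by trailing zeros.
  infix 4 _≈_
  _≈_ : List ℤ → List ℤ → Set
  p ≈ q = ∀ k → coeff p k ≡ coeff q k

  coeff-toList : ∀ {n} (v : Vec ℤ n) i → coeff (toList v) (toℕ i) ≡ Vec.lookup v i
  coeff-toList (a ∷ v) zero    = refl
  coeff-toList (a ∷ v) (suc i) = coeff-toList v i

  toList-≈-injective : ∀ {n} (v w : Vec ℤ n) → toList v ≈ toList w → v ≡ w
  toList-≈-injective []      []      _   = refl
  toList-≈-injective (a ∷ v) (b ∷ w) v≈w = cong₂ _∷_ (v≈w 0) (toList-≈-injective v w (v≈w ∘ suc))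

  Degree< : List ℤ → ℕ → Set
  Degree< p n = ∀ k → n ≤ k → coeff p k ≡ 0ℤ

  HasDegree : List ℤ → ℕ → Set
  HasDegree p a = coeff p a ≢ 0ℤ × Degree< p (suc a)

  Degree<-length : ∀ p → Degree< p (length p)
  Degree<-length []      k       _       = refl
  Degree<-length (a ∷ p) (suc k) (s≤s n≤k) = Degree<-length p k n≤k

  Degree<-toList : ∀ {n} (v : Vec ℤ n) → Degree< (toList v) n
  Degree<-toList {n} v k n≤k = Degree<-length (toList v) k (subst (_≤ k) (sym (Vecₚ.length-toList v)) n≤k)

  Degree<-resp-≈ : ∀ p q {n} → p ≈ q → Degree< p n → Degree< q n
  Degree<-resp-≈ p q p≈q deg k n≤k = trans (sym (p≈q k)) (deg k n≤k)

  degree : ∀ p → p ≈ [] ⊎ ∃ (HasDegree p)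
  degree []      = inj₁ (λ _ → refl)
  degree (a ∷ p) with degree p
  ... | inj₂ (d , p[d]≢0 , deg) = inj₂ (suc d , p[d]≢0 , λ { (suc k) (s≤s d<k) → deg k d<k })
  ... | inj₁ p≈[] with a ℤ.≟ 0ℤ
  ...   | yes a≡0 = inj₁ λ { zero → a≡0 ; (suc k) → p≈[] k }
  ...   | no  a≢0 = inj₂ (0 , a≢0 , λ { (suc k) _ → p≈[] k })

  infixl 6 _⊕_
  infixr 7 _·_
  infixl 7 _⊛_

  _⊕_ : List ℤ → List ℤ → List ℤ
  []      ⊕ q       = q
  (a ∷ p) ⊕ []      = a ∷ p
  (a ∷ p) ⊕ (b ∷ q) = a + b ∷ p ⊕ q

  _·_ : ℤ → List ℤ → List ℤ
  c · p = map (c *_) p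

  _⊛_ : List ℤ → List ℤ → List ℤ
  []      ⊛ r = []
  (c ∷ q) ⊛ r = c · r ⊕ (0ℤ ∷ q ⊛ r)

  eval : List ℤ → ℤ → ℤ
  eval []      x = 0ℤ
  eval (a ∷ p) x = a + x * eval p x

  coeff-⊕ : ∀ p q k → coeff (p ⊕ q) k ≡ coeff p k + coeff q k
  coeff-⊕ []      q       k       = sym (ℤₚ.+-identityˡ (coeff q k))
  coeff-⊕ (a ∷ p) []      k       = sym (ℤₚ.+-identityʳ (coeff (a ∷ p) k))
  coeff-⊕ (a ∷ p) (b ∷ q) zero    = refl
  coeff-⊕ (a ∷ p) (b ∷ q) (suc k) = coeff-⊕ p q k

  coeff-· : ∀ c p k → coeff (c · p) k ≡ c * coeff p k
  coeff-· c []      k       = sym (ℤₚ.*-zeroʳ c)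
  coeff-· c (a ∷ p) zero    = refl
  coeff-· c (a ∷ p) (suc k) = coeff-· c p k

  mulCoeff-∷ : ∀ c q r k → mulCoeff (c ∷ q) r (suc k) ≡ c * coeff r (suc k) + mulCoeff q r k
  mulCoeff-∷ c q r k = sumTo-shift k (λ i → coeff (c ∷ q) i * coeff r (suc k ∸ i))

  coeff-∷-⊛-zero : ∀ c q r → coeff ((c ∷ q) ⊛ r) 0 ≡ c * coeff r 0
  coeff-∷-⊛-zero c q r = trans (coeff-⊕ (c · r) (0ℤ ∷ q ⊛ r) 0) (trans (ℤₚ.+-identityʳ _) (coeff-· c r 0))

  coeff-∷-⊛-suc : ∀ c q r k → coeff ((c ∷ q) ⊛ r) (suc k) ≡ c * coeff r (suc k) + coeff (q ⊛ r) k
  coeff-∷-⊛-suc c q r k = trans (coeff-⊕ (c · r) (0ℤ ∷ q ⊛ r) (suc k)) (cong (_+ coeff (q ⊛ r) k) (coeff-· c r (suc k)))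

  coeff-⊛ : ∀ q r k → coeff (q ⊛ r) k ≡ mulCoeff q r k
  coeff-⊛ []      r k       = sym (sumTo-zero k (λ i _ → ℤₚ.*-zeroˡ (coeff r (k ∸ i))))
  coeff-⊛ (c ∷ q) r zero    = coeff-∷-⊛-zero c q r
  coeff-⊛ (c ∷ q) r (suc k) = begin
    coeff ((c ∷ q) ⊛ r) (suc k)             ≡⟨ coeff-∷-⊛-suc c q r k ⟩
    c * coeff r (suc k) + coeff (q ⊛ r) k   ≡⟨ cong (_+_ (c * coeff r (suc k))) (coeff-⊛ q r k) ⟩
    c * coeff r (suc k) + mulCoeff q r k    ≡⟨ mulCoeff-∷ c q r k ⟨
    mulCoeff (c ∷ q) r (suc k)              ∎
    where open ≡-Reasoning

  eval-⊕ : ∀ p q x → eval (p ⊕ q) x ≡ eval p x + eval q x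
  eval-⊕ []      q       x = sym (ℤₚ.+-identityˡ (eval q x))
  eval-⊕ (a ∷ p) []      x = sym (ℤₚ.+-identityʳ (eval (a ∷ p) x))
  eval-⊕ (a ∷ p) (b ∷ q) x = trans (cong (λ e → a + b + x * e) (eval-⊕ p q x))
                                   (lemma a b x (eval p x) (eval q x))
    where
    lemma : ∀ a b x e f → a + b + x * (e + f) ≡ (a + x * e) + (b + x * f)
    lemma = solve-∀

  eval-· : ∀ c p x → eval (c · p) x ≡ c * eval p x
  eval-· c []      x = sym (ℤₚ.*-zeroʳ c)
  eval-· c (a ∷ p) x = trans (cong (λ e → c * a + x * e) (eval-· c p x)) (lemma c a x (eval p x))
    where
    lemma : ∀ c a x e → c * a + x * (c * e) ≡ c * (a + x * e)
    lemma = solve-∀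

  eval-⊛ : ∀ q r x → eval (q ⊛ r) x ≡ eval q x * eval r x
  eval-⊛ []      r x = sym (ℤₚ.*-zeroˡ (eval r x))
  eval-⊛ (c ∷ q) r x = begin
    eval (c · r ⊕ (0ℤ ∷ q ⊛ r)) x                ≡⟨ eval-⊕ (c · r) (0ℤ ∷ q ⊛ r) x ⟩
    eval (c · r) x + (0ℤ + x * eval (q ⊛ r) x)   ≡⟨ cong₂ (λ e f → e + (0ℤ + x * f)) (eval-· c r x) (eval-⊛ q r x) ⟩
    c * eval r x + (0ℤ + x * (eval q x * eval r x)) ≡⟨ lemma c x (eval q x) (eval r x) ⟩
    (c + x * eval q x) * eval r x                ∎
    where
    open ≡-Reasoning
    lemma : ∀ c x e f → c * f + (0ℤ + x * (e * f)) ≡ (c + x * e) * f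
    lemma = solve-∀

  eval-≈[] : ∀ p x → p ≈ [] → eval p x ≡ 0ℤ
  eval-≈[] []      x p≈[] = refl
  eval-≈[] (a ∷ p) x p≈[] = trans (cong₂ (λ a e → a + x * e) (p≈[] 0) (eval-≈[] p x (p≈[] ∘ suc)))
                                 (trans (ℤₚ.+-identityˡ (x * 0ℤ)) (ℤₚ.*-zeroʳ x))

  eval-cong : ∀ p q x → p ≈ q → eval p x ≡ eval q x
  eval-cong []      q       x p≈q = sym (eval-≈[] q x (sym ∘ p≈q))
  eval-cong (a ∷ p) []      x p≈q = eval-≈[] (a ∷ p) x p≈q
  eval-cong (a ∷ p) (b ∷ q) x p≈q = cong₂ (λ a e → a + x * e) (p≈q 0) (eval-cong p q x (p≈q ∘ suc))

  ⊛-comm : ∀ q r → q ⊛ r ≈ r ⊛ q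
  ⊛-comm q r k = begin
    coeff (q ⊛ r) k                                         ≡⟨ coeff-⊛ q r k ⟩
    mulCoeff q r k                                          ≡⟨ sumTo-reverse k _ ⟨
    sumTo k (λ i → coeff q (k ∸ i) * coeff r (k ∸ (k ∸ i))) ≡⟨ sumTo-cong k swap ⟩
    mulCoeff r q k                                          ≡⟨ coeff-⊛ r q k ⟨
    coeff (r ⊛ q) k                                         ∎
    where
    open ≡-Reasoning
    swap : ∀ i → i ≤ k → coeff q (k ∸ i) * coeff r (k ∸ (k ∸ i)) ≡ coeff r i * coeff q (k ∸ i)
    swap i i≤k = trans (cong (λ j → coeff q (k ∸ i) * coeff r j) (ℕₚ.m∸[m∸n]≡n i≤k))
                       (ℤₚ.*-comm (coeff q (k ∸ i)) (coeff r i))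

  ⊛-cong : ∀ q q′ r r′ → q ≈ q′ → r ≈ r′ → q ⊛ r ≈ q′ ⊛ r′
  ⊛-cong q q′ r r′ q≈q′ r≈r′ k = begin
    coeff (q ⊛ r) k     ≡⟨ coeff-⊛ q r k ⟩
    mulCoeff q r k      ≡⟨ sumTo-cong k (λ i _ → cong₂ _*_ (q≈q′ i) (r≈r′ (k ∸ i))) ⟩
    mulCoeff q′ r′ k    ≡⟨ coeff-⊛ q′ r′ k ⟨
    coeff (q′ ⊛ r′) k   ∎
    where open ≡-Reasoning

  module _ (q r : List ℤ) {a b : ℕ} (degq : Degree< q (suc a)) (degr : Degree< r (suc b)) where

    private
      term≡0 : ∀ k i → (i ≤ a → suc (i ℕ.+ b) ≤ k) → coeff q i * coeff r (k ∸ i) ≡ 0ℤ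
      term≡0 k i bound with i ℕ.≤? a
      ... | yes i≤a = trans (cong (coeff q i *_) (degr (k ∸ i) b<k∸i)) (ℤₚ.*-zeroʳ (coeff q i))
        where
        b<k∸i : suc b ≤ k ∸ i
        b<k∸i = subst (_≤ k ∸ i) (trans (cong (_∸ i) (sym (ℕₚ.+-suc i b))) (ℕₚ.m+n∸m≡n i (suc b)))
                      (ℕₚ.∸-monoˡ-≤ i (bound i≤a))
      ... | no  i≰a = trans (cong (_* coeff r (k ∸ i)) (degq i (ℕₚ.≰⇒> i≰a))) (ℤₚ.*-zeroˡ (coeff r (k ∸ i)))

    Degree<-⊛ : Degree< (q ⊛ r) (suc (a ℕ.+ b))
    Degree<-⊛ k a+b<k = trans (coeff-⊛ q r k)
      (sumTo-zero k (λ i _ → term≡0 k i (λ i≤a → ℕₚ.≤-trans (s≤s (ℕₚ.+-monoˡ-≤ b i≤a)) a+b<k)))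

    coeff-⊛-leading : coeff (q ⊛ r) (a ℕ.+ b) ≡ coeff q a * coeff r b
    coeff-⊛-leading = begin
      coeff (q ⊛ r) (a ℕ.+ b)                     ≡⟨ coeff-⊛ q r (a ℕ.+ b) ⟩
      mulCoeff q r (a ℕ.+ b)                      ≡⟨ sumTo-single (a ℕ.+ b) (ℕₚ.m≤m+n a b) others ⟩
      coeff q a * coeff r (a ℕ.+ b ∸ a)           ≡⟨ cong (λ j → coeff q a * coeff r j) (ℕₚ.m+n∸m≡n a b) ⟩
      coeff q a * coeff r b                       ∎
      where
      open ≡-Reasoning
      others : ∀ i → i ≤ a ℕ.+ b → i ≢ a → coeff q i * coeff r (a ℕ.+ b ∸ i) ≡ 0ℤ
      others i _ i≢a = term≡0 (a ℕ.+ b) i (λ i≤a → ℕₚ.+-monoˡ-≤ b (ℕₚ.≤∧≢⇒< i≤a i≢a))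

  HasDegree-⊛ : ∀ q r {a b} → HasDegree q a → HasDegree r b → HasDegree (q ⊛ r) (a ℕ.+ b)
  HasDegree-⊛ q r {a} {b} (q[a]≢0 , degq) (r[b]≢0 , degr) = lead≢0 , Degree<-⊛ q r degq degr
    where
    lead≢0 : coeff (q ⊛ r) (a ℕ.+ b) ≢ 0ℤ
    lead≢0 eq with ℤₚ.i*j≡0⇒i≡0∨j≡0 (coeff q a) (trans (sym (coeff-⊛-leading q r degq degr)) eq)
    ... | inj₁ q[a]≡0 = q[a]≢0 q[a]≡0
    ... | inj₂ r[b]≡0 = r[b]≢0 r[b]≡0

  HasDegree-resp-≈ : ∀ p q {a} → p ≈ q → HasDegree p a → HasDegree q a
  HasDegree-resp-≈ p q {a} p≈q (p[a]≢0 , deg) = (p[a]≢0 ∘ trans (p≈q a)) , Degree<-resp-≈ p q p≈q deg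

  HasDegree-unique : ∀ p {a b} → HasDegree p a → HasDegree p b → a ≡ b
  HasDegree-unique p (p[a]≢0 , dega) (p[b]≢0 , degb) =
    ℕₚ.≤-antisym (ℕₚ.≮⇒≥ (λ b<a → p[a]≢0 (degb _ b<a))) (ℕₚ.≮⇒≥ (λ a<b → p[b]≢0 (dega _ a<b)))

  linear : ℤ → ℤ → List ℤ
  linear c₀ c₁ = c₀ ∷ c₁ ∷ []

  coeff-[c]-⊛ : ∀ c g k → coeff ((c ∷ []) ⊛ g) k ≡ c * coeff g k
  coeff-[c]-⊛ c g zero    = coeff-∷-⊛-zero c [] g
  coeff-[c]-⊛ c g (suc k) = trans (coeff-∷-⊛-suc c [] g k) (ℤₚ.+-identityʳ (c * coeff g (suc k)))

  coeff-linear-⊛-suc : ∀ c₀ c₁ g k → coeff (linear c₀ c₁ ⊛ g) (suc k) ≡ c₀ * coeff g (suc k) + c₁ * coeff g k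
  coeff-linear-⊛-suc c₀ c₁ g k =
    trans (coeff-∷-⊛-suc c₀ (c₁ ∷ []) g k) (cong (_+_ (c₀ * coeff g (suc k))) (coeff-[c]-⊛ c₁ g k))

  -- Synthetic division by X − c.
  divide : ℤ → ∀ {d} → Vec ℤ (suc d) → Vec ℤ d × ℤ
  divide c (a ∷ [])          = [] , a
  divide c (a ∷ v@(_ ∷ _)) = proj₂ (divide c v) ∷ proj₁ (divide c v) , a + c * proj₂ (divide c v)

  quotient : ℤ → ∀ {d} → Vec ℤ (suc d) → Vec ℤ d
  quotient c v = proj₁ (divide c v)

  remainder : ℤ → ∀ {d} → Vec ℤ (suc d) → ℤ
  remainder c v = proj₂ (divide c v)

  eval-divide : ∀ c {d} (v : Vec ℤ (suc d)) x →
                eval (toList v) x ≡ (x - c) * eval (toList (quotient c v)) x + remainder c v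
  eval-divide c (a ∷ [])        x = lemma a x c
    where
    lemma : ∀ a x c → a + x * 0ℤ ≡ (x - c) * 0ℤ + a
    lemma = solve-∀
  eval-divide c (a ∷ v@(_ ∷ _)) x =
    trans (cong (λ e → a + x * e) (eval-divide c v x))
          (lemma a x c (eval (toList (quotient c v)) x) (remainder c v))
    where
    lemma : ∀ a x c e ρ → a + x * ((x - c) * e + ρ) ≡ (x - c) * (ρ + x * e) + (a + c * ρ)
    lemma = solve-∀

  remainder-divide : ∀ c {d} (v : Vec ℤ (suc d)) → remainder c v ≡ eval (toList v) c
  remainder-divide c v = sym (trans (eval-divide c v c) (lemma c (eval (toList (quotient c v)) c) (remainder c v)))
    where
    lemma : ∀ c e ρ → (c - c) * e + ρ ≡ ρ
    lemma = solve-∀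

  coeff-divide-zero : ∀ c {d} (v : Vec ℤ (suc d)) →
    coeff (toList v) 0 ≡ - c * coeff (toList (quotient c v)) 0 + remainder c v
  coeff-divide-zero c (a ∷ [])        = lemma a c
    where
    lemma : ∀ a c → a ≡ - c * 0ℤ + a
    lemma = solve-∀
  coeff-divide-zero c (a ∷ v@(_ ∷ _)) = lemma a c (remainder c v)
    where
    lemma : ∀ a c ρ → a ≡ - c * ρ + (a + c * ρ)
    lemma = solve-∀

  coeff-divide-suc : ∀ c {d} (v : Vec ℤ (suc d)) k →
    coeff (toList v) (suc k) ≡ - c * coeff (toList (quotient c v)) (suc k) + coeff (toList (quotient c v)) k
  coeff-divide-suc c (a ∷ [])        k       = lemma c
    where
    lemma : ∀ c → 0ℤ ≡ - c * 0ℤ + 0ℤ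
    lemma = solve-∀
  coeff-divide-suc c (a ∷ v@(_ ∷ _)) zero    = coeff-divide-zero c v
  coeff-divide-suc c (a ∷ v@(_ ∷ _)) (suc k) = coeff-divide-suc c v k

  factor-theorem : ∀ c {d} (v : Vec ℤ (suc d)) → eval (toList v) c ≡ 0ℤ →
                   toList v ≈ linear (- c) 1ℤ ⊛ toList (quotient c v)
  factor-theorem c v root zero    = begin
    coeff (toList v) 0                       ≡⟨ coeff-divide-zero c v ⟩
    - c * coeff g 0 + remainder c v          ≡⟨ cong (_+_ (- c * coeff g 0)) (trans (remainder-divide c v) root) ⟩
    - c * coeff g 0 + 0ℤ                     ≡⟨ ℤₚ.+-identityʳ _ ⟩
    - c * coeff g 0                          ≡⟨ coeff-∷-⊛-zero (- c) (1ℤ ∷ []) g ⟨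
    coeff (linear (- c) 1ℤ ⊛ g) 0            ∎
    where
    open ≡-Reasoning
    g = toList (quotient c v)
  factor-theorem c v root (suc k) = begin
    coeff (toList v) (suc k)                 ≡⟨ coeff-divide-suc c v k ⟩
    - c * coeff g (suc k) + coeff g k        ≡⟨ cong (_+_ (- c * coeff g (suc k))) (ℤₚ.*-identityˡ (coeff g k)) ⟨
    - c * coeff g (suc k) + 1ℤ * coeff g k   ≡⟨ coeff-linear-⊛-suc (- c) 1ℤ g k ⟨
    coeff (linear (- c) 1ℤ ⊛ g) (suc k)      ∎
    where
    open ≡-Reasoning
    g = toList (quotient c v)

  divide-injective : ∀ c {d} (v w : Vec ℤ (suc d)) →
                     quotient c v ≡ quotient c w → remainder c v ≡ remainder c w → v ≡ w
  divide-injective c (a ∷ [])        (b ∷ [])        _   ρ≡σ = cong (_∷ []) ρ≡σ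
  divide-injective c (a ∷ v@(_ ∷ _)) (b ∷ w@(_ ∷ _)) g≡h ρ≡σ =
    cong₂ _∷_ a≡b (divide-injective c v w (Vecₚ.∷-injectiveʳ g≡h) (Vecₚ.∷-injectiveˡ g≡h))
    where
    a≡b : a ≡ b
    a≡b = +-cancelʳ (c * remainder c v) a b
            (trans ρ≡σ (cong (λ ρ → b + c * ρ) (sym (Vecₚ.∷-injectiveˡ g≡h))))

  -- Divide both by X − d: the remainders are the values at d, and the quotients agree on 0 … d − 1.
  interpolation-uniqueᵥ : ∀ d (v w : Vec ℤ (suc d)) →
    (∀ x → x ≤ d → eval (toList v) (+ x) ≡ eval (toList w) (+ x)) → v ≡ w
  interpolation-uniqueᵥ zero    (a ∷ []) (b ∷ []) agree =
    cong (_∷ []) (trans (sym (ℤₚ.+-identityʳ a)) (trans (agree 0 z≤n) (ℤₚ.+-identityʳ b)))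
  interpolation-uniqueᵥ (suc d) v w agree =
    divide-injective c v w (interpolation-uniqueᵥ d (quotient c v) (quotient c w) agree′) ρ≡σ
    where
    c = + suc d
    ρ≡σ : remainder c v ≡ remainder c w
    ρ≡σ = trans (remainder-divide c v) (trans (agree (suc d) ℕₚ.≤-refl) (sym (remainder-divide c w)))
    agree′ : ∀ x → x ≤ d → eval (toList (quotient c v)) (+ x) ≡ eval (toList (quotient c w)) (+ x)
    agree′ x x≤d = ℤₚ.*-cancelˡ-≡ (+ x - c) _ _ {{ℤ.≢-nonZero x-c≢0}} (+-cancelʳ (remainder c v) _ _ (begin
      (+ x - c) * eval (toList (quotient c v)) (+ x) + remainder c v ≡⟨ eval-divide c v (+ x) ⟨
      eval (toList v) (+ x)                                          ≡⟨ agree x (ℕₚ.m≤n⇒m≤1+n x≤d) ⟩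
      eval (toList w) (+ x)                                          ≡⟨ eval-divide c w (+ x) ⟩
      (+ x - c) * eval (toList (quotient c w)) (+ x) + remainder c w ≡⟨ cong (_+_ ((+ x - c) * eval (toList (quotient c w)) (+ x))) ρ≡σ ⟨
      (+ x - c) * eval (toList (quotient c w)) (+ x) + remainder c v ∎))
      where
      open ≡-Reasoning
      x-c≢0 : + x - c ≢ 0ℤ
      x-c≢0 eq = ℕₚ.<⇒≢ (s≤s x≤d) (ℤₚ.+-injective (ℤₚ.i-j≡0⇒i≡j (+ x) c eq))

  truncate : ∀ d → List ℤ → Vec ℤ (suc d)
  truncate zero    p       = coeff p 0 ∷ []
  truncate (suc d) []      = 0ℤ ∷ truncate d []
  truncate (suc d) (a ∷ p) = a ∷ truncate d p

  toList-truncate : ∀ d p → Degree< p (suc d) → toList (truncate d p) ≈ p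
  toList-truncate zero    p       deg zero    = refl
  toList-truncate zero    p       deg (suc k) = sym (deg (suc k) (s≤s z≤n))
  toList-truncate (suc d) []      deg zero    = refl
  toList-truncate (suc d) []      deg (suc k) = toList-truncate d [] (λ _ _ → refl) k
  toList-truncate (suc d) (a ∷ p) deg zero    = refl
  toList-truncate (suc d) (a ∷ p) deg (suc k) = toList-truncate d p (λ k d<k → deg (suc k) (s≤s d<k)) k

  interpolation-unique : ∀ d p q → Degree< p (suc d) → Degree< q (suc d) →
    (∀ x → x ≤ d → eval p (+ x) ≡ eval q (+ x)) → p ≈ q
  interpolation-unique d p q degp degq agree k = begin
    coeff p k                        ≡⟨ toList-truncate d p degp k ⟨
    coeff (toList (truncate d p)) k  ≡⟨ cong (λ v → coeff (toList v) k) (interpolation-uniqueᵥ d (truncate d p) (truncate d q) agree′) ⟩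
    coeff (toList (truncate d q)) k  ≡⟨ toList-truncate d q degq k ⟩
    coeff q k                        ∎
    where
    open ≡-Reasoning
    agree′ : ∀ x → x ≤ d → eval (toList (truncate d p)) (+ x) ≡ eval (toList (truncate d q)) (+ x)
    agree′ x x≤d = trans (eval-cong (toList (truncate d p)) p (+ x) (toList-truncate d p degp))
                         (trans (agree x x≤d) (sym (eval-cong (toList (truncate d q)) q (+ x) (toList-truncate d q degq))))

  X⊛ : ∀ w → linear 0ℤ 1ℤ ⊛ w ≈ 0ℤ ∷ w
  X⊛ w zero    = trans (coeff-∷-⊛-zero 0ℤ (1ℤ ∷ []) w) (ℤₚ.*-zeroˡ (coeff w 0))
  X⊛ w (suc k) = trans (coeff-linear-⊛-suc 0ℤ 1ℤ w k)
                       (trans (cong₂ ℤ._+_ (ℤₚ.*-zeroˡ (coeff w (suc k))) (ℤₚ.*-identityˡ (coeff w k)))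
                              (ℤₚ.+-identityˡ (coeff w k)))

open Polynomials

module LinearFactors where

  open import Data.Nat using (_+_; _*_)
  open import Data.Integer.Tactic.RingSolver using (solve-∀)

  ∣i∣≤∣i+j∣+∣j∣ : ∀ i j → ∣ i ∣ ≤ ∣ i ℤ.+ j ∣ + ∣ j ∣
  ∣i∣≤∣i+j∣+∣j∣ i j =
    subst (λ k → ∣ k ∣ ≤ ∣ i ℤ.+ j ∣ + ∣ j ∣) (lemma i j) (ℤₚ.∣i-j∣≤∣i∣+∣j∣ (i ℤ.+ j) j)
    where
    lemma : ∀ i j → i ℤ.+ j ℤ.- j ≡ i
    lemma = solve-∀

  module _ {n T : ℕ} (c₀ c₁ : ℤ) (g p : List ℤ) (deg : Degree< g n)
           (height : ∀ k → ∣ coeff p k ∣ ≤ T) (p≈ : p ≈ linear c₀ c₁ ⊛ g) where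

    private
      G : ℕ → ℤ
      G = coeff g

      recurrence : ∀ k → coeff p (suc k) ≡ c₀ ℤ.* G (suc k) ℤ.+ c₁ ℤ.* G k
      recurrence k = trans (p≈ (suc k)) (coeff-linear-⊛-suc c₀ c₁ g k)

      ∣summand∣≤ : ∀ {i j} k → coeff p (suc k) ≡ i ℤ.+ j → ∣ i ∣ ≤ T + ∣ j ∣
      ∣summand∣≤ {i} {j} k eq = ℕₚ.≤-trans (∣i∣≤∣i+j∣+∣j∣ i j)
        (ℕₚ.+-monoˡ-≤ ∣ j ∣ (subst (λ z → ∣ z ∣ ≤ T) eq (height (suc k))))

      ∣c₀G∣≤ : ∀ k → ∣ c₀ ∣ * ∣ G (suc k) ∣ ≤ T + ∣ c₁ ∣ * ∣ G k ∣
      ∣c₀G∣≤ k = subst₂ _≤_ (ℤₚ.abs-* c₀ (G (suc k))) (cong (_+_ T) (ℤₚ.abs-* c₁ (G k)))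
                        (∣summand∣≤ {c₀ ℤ.* G (suc k)} {c₁ ℤ.* G k} k (recurrence k))

      ∣c₁G∣≤ : ∀ k → ∣ c₁ ∣ * ∣ G k ∣ ≤ T + ∣ c₀ ∣ * ∣ G (suc k) ∣
      ∣c₁G∣≤ k = subst₂ _≤_ (ℤₚ.abs-* c₁ (G k)) (cong (_+_ T) (ℤₚ.abs-* c₀ (G (suc k))))
                        (∣summand∣≤ {c₁ ℤ.* G k} {c₀ ℤ.* G (suc k)} k
                                    (trans (recurrence k) (ℤₚ.+-comm (c₀ ℤ.* G (suc k)) (c₁ ℤ.* G k))))

      ascending : ∣ c₁ ∣ ≤ ∣ c₀ ∣ → ∀ k → ∣ c₀ ∣ * ∣ G k ∣ ≤ suc k * T
      ascending _ zero = begin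
        ∣ c₀ ∣ * ∣ G 0 ∣           ≡⟨ ℤₚ.abs-* c₀ (G 0) ⟨
        ∣ c₀ ℤ.* G 0 ∣             ≡⟨ cong ∣_∣ (sym (trans (p≈ 0) (coeff-∷-⊛-zero c₀ (c₁ ∷ []) g))) ⟩
        ∣ coeff p 0 ∣              ≤⟨ height 0 ⟩
        T                          ≡⟨ ℕₚ.+-identityʳ T ⟨
        1 * T                      ∎
        where open ℕₚ.≤-Reasoning
      ascending c₁≤c₀ (suc k) = ℕₚ.≤-trans (∣c₀G∣≤ k)
        (ℕₚ.+-monoʳ-≤ T (ℕₚ.≤-trans (ℕₚ.*-monoˡ-≤ ∣ G k ∣ c₁≤c₀) (ascending c₁≤c₀ k)))

      descending : ∣ c₀ ∣ ≤ ∣ c₁ ∣ → ∀ d k → n ≤ k + d → ∣ c₁ ∣ * ∣ G k ∣ ≤ d * T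
      descending _ zero k n≤k = ℕₚ.≤-reflexive
        (trans (cong (λ a → ∣ c₁ ∣ * ∣ a ∣) (deg k (subst (n ≤_) (ℕₚ.+-identityʳ k) n≤k))) (ℕₚ.*-zeroʳ ∣ c₁ ∣))
      descending c₀≤c₁ (suc d) k n≤k+1+d = ℕₚ.≤-trans (∣c₁G∣≤ k)
        (ℕₚ.+-monoʳ-≤ T (ℕₚ.≤-trans (ℕₚ.*-monoˡ-≤ ∣ G (suc k) ∣ c₀≤c₁)
          (descending c₀≤c₁ d (suc k) (subst (n ≤_) (ℕₚ.+-suc k d) n≤k+1+d))))

    linear-factor-bound : ∀ k → (∣ c₀ ∣ ⊔ ∣ c₁ ∣) * ∣ coeff g k ∣ ≤ n * T
    linear-factor-bound k with ∣ c₁ ∣ ℕₚ.≤? ∣ c₀ ∣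
    ... | yes c₁≤c₀ rewrite ℕₚ.m≥n⇒m⊔n≡m c₁≤c₀ with k ℕₚ.<? n
    ...   | yes k<n = ℕₚ.≤-trans (ascending c₁≤c₀ k) (ℕₚ.*-monoˡ-≤ T k<n)
    ...   | no  k≮n = subst (_≤ n * T)
                         (sym (trans (cong (λ a → ∣ c₀ ∣ * ∣ a ∣) (deg k (ℕₚ.≮⇒≥ k≮n))) (ℕₚ.*-zeroʳ ∣ c₀ ∣))) z≤n
    linear-factor-bound k | no c₁≰c₀ rewrite ℕₚ.m≤n⇒m⊔n≡n (ℕₚ.<⇒≤ (ℕₚ.≰⇒> c₁≰c₀)) =
      descending (ℕₚ.<⇒≤ (ℕₚ.≰⇒> c₁≰c₀)) n k (ℕₚ.m≤n+m n k)

open LinearFactors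

module Factorisations where

  open import Data.Integer using (-_)

  LinearFactorisation : ∀ {n} → Vec ℤ (suc n) → Set
  LinearFactorisation {n} p = ∃₂ λ c₀ c₁ → Σ (Vec ℤ n) λ g → toList p ≈ linear c₀ c₁ ⊛ toList g

  record WideFactorisation {n : ℕ} (p : Vec ℤ (suc n)) : Set where
    field
      q r         : List ℤ
      a b         : ℕ
      deg-q       : Degree< q (3 ℕ.+ a)
      deg-r       : Degree< r (3 ℕ.+ b)
      degree-sum  : 4 ℕ.+ (a ℕ.+ b) ≡ n
      factors     : toList p ≈ q ⊛ r
      no-root     : ∀ x → x ≤ n → eval (toList p) (+ x) ≢ 0ℤ

  Degree<2⇒≈linear : ∀ q → Degree< q 2 → q ≈ linear (coeff q 0) (coeff q 1)
  Degree<2⇒≈linear q deg zero          = refl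
  Degree<2⇒≈linear q deg (suc zero)    = refl
  Degree<2⇒≈linear q deg (suc (suc k)) = deg (suc (suc k)) (s≤s (s≤s z≤n))

  HasDegree-toList : ∀ {n} (p : Vec ℤ (suc n)) → lookup p (fromℕ n) ≢ 0ℤ → HasDegree (toList p) n
  HasDegree-toList {n} p lead≢0 =
    (λ p[n]≡0 → lead≢0 (trans (sym (coeff-toList p (fromℕ n))) (trans (cong (coeff (toList p)) (Finₚ.toℕ-fromℕ n)) p[n]≡0))) ,
    Degree<-toList p

  module _ {n : ℕ} (p : Vec ℤ (suc n)) (lead≢0 : lookup p (fromℕ n) ≢ 0ℤ) (qᵥ rᵥ : Vec ℤ n)
           (p≈qr : toList p ≈ toList qᵥ ⊛ toList rᵥ) where

    private
      q = toList qᵥ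
      r = toList rᵥ

      wide-or-root : ∀ a b → 4 ℕ.+ (a ℕ.+ b) ≡ n → Degree< q (3 ℕ.+ a) → Degree< r (3 ℕ.+ b) →
                     LinearFactorisation p ⊎ WideFactorisation p
      wide-or-root a b a+b+4≡n degq degr with ℕₚ.anyUpTo? (λ x → eval (toList p) (+ x) ℤ.≟ 0ℤ) (suc n)
      ... | yes (x , _ , root) = inj₁ (- + x , 1ℤ , quotient (+ x) p , factor-theorem (+ x) p root)
      ... | no  no-root        = inj₂ (record
        { q = q ; r = r ; a = a ; b = b ; deg-q = degq ; deg-r = degr ; degree-sum = a+b+4≡n
        ; factors = p≈qr ; no-root = λ x x≤n root → no-root (x , s≤s x≤n , root) })

      linear-left : Degree< q 2 → LinearFactorisation p
      linear-left deg = coeff q 0 , coeff q 1 , rᵥ ,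
        λ k → trans (p≈qr k) (⊛-cong q (linear (coeff q 0) (coeff q 1)) r r (Degree<2⇒≈linear q deg) (λ _ → refl) k)

      linear-right : Degree< r 2 → LinearFactorisation p
      linear-right deg = coeff r 0 , coeff r 1 , qᵥ ,
        λ k → trans (p≈qr k) (trans (⊛-comm q r k)
                    (⊛-cong r (linear (coeff r 0) (coeff r 1)) q q (Degree<2⇒≈linear r deg) (λ _ → refl) k))

      by-degrees : ∀ a b → a ℕ.+ b ≡ n → Degree< q (suc a) → Degree< r (suc b) →
                   LinearFactorisation p ⊎ WideFactorisation p
      by-degrees zero                b             _     degq _    = inj₁ (linear-left (λ k 2≤k → degq k (ℕₚ.≤-trans (s≤s z≤n) 2≤k)))
      by-degrees (suc zero)          b             _     degq _    = inj₁ (linear-left degq)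
      by-degrees (suc (suc a))       zero          _     _    degr = inj₁ (linear-right (λ k 2≤k → degr k (ℕₚ.≤-trans (s≤s z≤n) 2≤k)))
      by-degrees (suc (suc a))       (suc zero)    _     _    degr = inj₁ (linear-right degr)
      by-degrees (suc (suc a))       (suc (suc b)) a+b≡n degq degr = wide-or-root a b a+b+4≡n degq degr
        where
        a+b+4≡n : 4 ℕ.+ (a ℕ.+ b) ≡ n
        a+b+4≡n = trans (cong (2 ℕ.+_) (sym (trans (ℕₚ.+-suc a (suc b)) (cong suc (ℕₚ.+-suc a b))))) a+b≡n

      degp : HasDegree (toList p) n
      degp = HasDegree-toList p lead≢0

    factorisation-cases : LinearFactorisation p ⊎ WideFactorisation p
    factorisation-cases with degree q | degree r
    ... | inj₁ q≈[] | _ = ⊥-elim (proj₁ degp (trans (p≈qr n) (⊛-cong q [] r r q≈[] (λ _ → refl) n)))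
    ... | _ | inj₁ r≈[] = ⊥-elim (proj₁ degp (trans (p≈qr n) (trans (⊛-cong q q r [] (λ _ → refl) r≈[] n) (⊛-comm q [] n))))
    ... | inj₂ (a , degq) | inj₂ (b , degr) =
      by-degrees a b (HasDegree-unique (q ⊛ r) (HasDegree-⊛ q r degq degr) (HasDegree-resp-≈ (toList p) (q ⊛ r) p≈qr degp))
                 (proj₂ degq) (proj₂ degr)

  reducible-cases : ∀ {n} (p : Vec ℤ (suc n)) → lookup p (fromℕ n) ≢ 0ℤ → Reducible n p →
                    LinearFactorisation p ⊎ WideFactorisation p
  reducible-cases p lead≢0 (qᵥ , rᵥ , p≡qr) =
    factorisation-cases p lead≢0 qᵥ rᵥ (λ k → sym (trans (coeff-⊛ (toList qᵥ) (toList rᵥ) k) (p≡qr k)))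

  values : List ℤ → ℕ → List ℤ
  values q k = applyUpTo (λ x → eval q (+ x)) k

  coeff-applyUpTo : ∀ (f : ℕ → ℤ) {k x} → x < k → coeff (applyUpTo f k) x ≡ f x
  coeff-applyUpTo f {suc k} {zero}  _   = refl
  coeff-applyUpTo f {suc k} {suc x} x<k = coeff-applyUpTo (f ∘ suc) (ℕₚ.≤-pred x<k)

  values-injective : ∀ q q′ {a a′} → Degree< q (suc a) → Degree< q′ (suc a′) →
                     values q (suc a) ≡ values q′ (suc a′) → q ≈ q′
  values-injective q q′ {a} {a′} degq degq′ same with a≡a′
    where
    a≡a′ : a ≡ a′
    a≡a′ = ℕₚ.suc-injective (trans (sym (Listₚ.length-applyUpTo (λ x → eval q (+ x)) (suc a)))
                                   (trans (cong length same) (Listₚ.length-applyUpTo (λ x → eval q′ (+ x)) (suc a′))))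
  ... | refl = interpolation-unique a q q′ degq degq′ λ x x≤a → begin
    eval q (+ x)                    ≡⟨ coeff-applyUpTo (λ x → eval q (+ x)) (s≤s x≤a) ⟨
    coeff (values q (suc a)) x      ≡⟨ cong (λ vs → coeff vs x) same ⟩
    coeff (values q′ (suc a)) x     ≡⟨ coeff-applyUpTo (λ x → eval q′ (+ x)) (s≤s x≤a) ⟩
    eval q′ (+ x)                   ∎
    where open ≡-Reasoning

  Code : Set
  Code = (ℤ × ℤ × List ℤ) ⊎ (List ℤ × List ℤ)

  valueCode : ∀ {n} {p : Vec ℤ (suc n)} → WideFactorisation p → List ℤ × List ℤ
  valueCode w = values q (3 ℕ.+ a) , values r (3 ℕ.+ b)
    where open WideFactorisation w

  Decodes : ∀ {n} → Vec ℤ (suc n) → Code → Set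
  Decodes p (inj₁ (c₀ , c₁ , g)) = toList p ≈ linear c₀ c₁ ⊛ g
  Decodes p (inj₂ c)             = Σ (WideFactorisation p) λ w → valueCode w ≡ c

  decode-unique : ∀ {n} (p p′ : Vec ℤ (suc n)) c → Decodes p c → Decodes p′ c → p ≡ p′
  decode-unique p p′ (inj₁ _) p≈ p′≈ = toList-≈-injective p p′ (λ k → trans (p≈ k) (sym (p′≈ k)))
  decode-unique p p′ (inj₂ _) (w , refl) (w′ , same) = toList-≈-injective p p′ λ k → begin
    coeff (toList p) k    ≡⟨ W.factors k ⟩
    coeff (W.q ⊛ W.r) k   ≡⟨ ⊛-cong W.q W′.q W.r W′.r q≈q′ r≈r′ k ⟩
    coeff (W′.q ⊛ W′.r) k ≡⟨ W′.factors k ⟨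
    coeff (toList p′) k   ∎
    where
    open ≡-Reasoning
    module W = WideFactorisation w
    module W′ = WideFactorisation w′
    q≈q′ : W.q ≈ W′.q
    q≈q′ = values-injective W.q W′.q W.deg-q W′.deg-q (sym (cong proj₁ same))
    r≈r′ : W.r ≈ W′.r
    r≈r′ = values-injective W.r W′.r W.deg-r W′.deg-r (sym (cong proj₂ same))

open Factorisations

module Covers where

  open import Data.Nat using (_+_; _*_; _^_)
  open import Data.Integer using (-_)
  open import Data.List using (_++_; map; cartesianProduct)
  open import Data.List.Relation.Unary.All using (All; []; _∷_)
  import Data.List.Relation.Unary.All.Properties as Allₚ
  open import Data.List.Relation.Unary.Any using (here; there; index)
  import Data.List.Relation.Unary.Any.Properties as Anyₚ
  open import Data.List.Membership.Propositional using (_∈_)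
  import Data.List.Membership.Propositional.Properties as ∈ₚ

  record Cover {A : Set} (P : A → Set) (N : ℕ) : Set where
    constructor cover
    field
      elements : List A
      length≤  : length elements ≤ N
      complete : ∀ {x} → P x → x ∈ elements

  open Cover

  count≤ : ∀ {A : Set} {P : A → Set} {N m} → Cover P N →
           (f : Fin m → A) → Injective _≡_ _≡_ f → (∀ i → P (f i)) → m ≤ N
  count≤ C f f-injective Pf = ℕₚ.≤-trans (Finₚ.injective⇒≤ position-injective) (length≤ C)
    where
    position : Fin _ → Fin (length (elements C))
    position i = index (complete C (Pf i))
    position-injective : Injective _≡_ _≡_ position
    position-injective {i} {j} same = f-injective (begin
      f i                             ≡⟨ Anyₚ.lookup-index (complete C (Pf i)) ⟩
      Data.List.lookup (elements C) (position i) ≡⟨ cong (Data.List.lookup (elements C)) same ⟩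
      Data.List.lookup (elements C) (position j) ≡⟨ Anyₚ.lookup-index (complete C (Pf j)) ⟨
      f j                             ∎)
      where open ≡-Reasoning

  module _ {A : Set} {P : A → Set} {N : ℕ} where

    Cover-≤ : ∀ {M} → N ≤ M → Cover P N → Cover P M
    Cover-≤ N≤M (cover xs len complete) = cover xs (ℕₚ.≤-trans len N≤M) complete

    Cover-⊆ : ∀ {Q : A → Set} → Q ⊆ P → Cover P N → Cover Q N
    Cover-⊆ Q⊆P (cover xs len complete) = cover xs len (complete ∘ Q⊆P)

    Cover-map : ∀ {B : Set} {Q : B → Set} (f : A → B) → (∀ {y} → Q y → ∃ λ x → P x × y ≡ f x) → Cover P N → Cover Q N
    Cover-map f preimage (cover xs len complete) =
      cover (map f xs) (subst (_≤ N) (sym (Listₚ.length-map f xs)) len) λ Qy →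
        let x , Px , y≡fx = preimage Qy in subst (_∈ map f xs) (sym y≡fx) (∈ₚ.∈-map⁺ f (complete Px))

    Cover-∪ : ∀ {Q : A → Set} {M} → Cover P N → Cover Q M → Cover (P ∪ Q) (N + M)
    Cover-∪ {Q} (cover xs lenx completex) (cover ys leny completey) =
      cover (xs ++ ys) (subst (_≤ _) (sym (Listₚ.length-++ xs)) (ℕₚ.+-mono-≤ lenx leny)) member
      where
      member : ∀ {x} → (P ∪ Q) x → x ∈ xs ++ ys
      member (inj₁ Px) = ∈ₚ.∈-++⁺ˡ (completex Px)
      member (inj₂ Qx) = ∈ₚ.∈-++⁺ʳ xs (completey Qx)

  length-cartesianProduct : ∀ {A B : Set} (xs : List A) (ys : List B) →
                            length (cartesianProduct xs ys) ≡ length xs * length ys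
  length-cartesianProduct []       ys = refl
  length-cartesianProduct (x ∷ xs) ys = trans (Listₚ.length-++ (map (x ,_) ys))
    (cong₂ _+_ (Listₚ.length-map (x ,_) ys) (length-cartesianProduct xs ys))

  Cover-× : ∀ {A B : Set} {P : A → Set} {Q : B → Set} {N M} → Cover P N → Cover Q M → Cover (P ⟨×⟩ Q) (N * M)
  Cover-× (cover xs lenx completex) (cover ys leny completey) =
    cover (cartesianProduct xs ys)
          (subst (_≤ _) (sym (length-cartesianProduct xs ys)) (ℕₚ.*-mono-≤ lenx leny))
          (λ (Px , Qy) → ∈ₚ.∈-cartesianProduct⁺ (completex Px) (completey Qy))

  Cover-⊎ : ∀ {A B : Set} {P : A → Set} {Q : B → Set} {N M} → Cover P N → Cover Q M → Cover (P ⟨⊎⟩ Q) (N + M)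
  Cover-⊎ {P = P} {Q} (cover xs lenx completex) (cover ys leny completey) =
    cover (map inj₁ xs ++ map inj₂ ys) length≤′ member
    where
    member : ∀ {c} → (P ⟨⊎⟩ Q) c → c ∈ map inj₁ xs ++ map inj₂ ys
    member {inj₁ x} Px = ∈ₚ.∈-++⁺ˡ (∈ₚ.∈-map⁺ inj₁ (completex Px))
    member {inj₂ y} Qy = ∈ₚ.∈-++⁺ʳ (map inj₁ xs) (∈ₚ.∈-map⁺ inj₂ (completey Qy))
    length≤′ : length (map inj₁ xs ++ map inj₂ ys) ≤ _
    length≤′ = subst (_≤ _) (sym (trans (Listₚ.length-++ (map inj₁ xs))
                                        (cong₂ _+_ (Listₚ.length-map inj₁ xs) (Listₚ.length-map inj₂ ys))))
                     (ℕₚ.+-mono-≤ lenx leny)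

  ∑< : ℕ → (ℕ → ℕ) → ℕ
  ∑< zero    f = 0
  ∑< (suc K) f = ∑< K f + f K

  syntax ∑< K (λ k → e) = ∑[ k < K ] e

  Cover-⋃ : ∀ {A : Set} {P : ℕ → A → Set} {N : ℕ → ℕ} → (∀ k → Cover (P k) (N k)) →
            ∀ K → Cover (λ x → ∃ λ k → k < K × P k x) (∑[ k < K ] N k)
  Cover-⋃ C zero    = cover [] z≤n λ { (k , () , _) }
  Cover-⋃ {P = P} C (suc K) = Cover-⊆ split (Cover-∪ (Cover-⋃ C K) (C K))
    where
    split : ∀ {x} → (∃ λ k → k < suc K × P k x) → (∃ λ k → k < K × P k x) ⊎ P K x
    split (k , s≤s k≤K , Pkx) with k ℕₚ.≟ K
    ... | yes refl = inj₂ Pkx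
    ... | no  k≢K  = inj₁ (k , ℕₚ.≤∧≢⇒< k≤K k≢K , Pkx)

  interval : ∀ M → Cover (λ z → ∣ z ∣ ≤ M) (suc (M + M))
  interval M = cover (applyUpTo (_⊖ M) (suc (M + M)))
                     (ℕₚ.≤-reflexive (Listₚ.length-applyUpTo (_⊖ M) (suc (M + M)))) member
    where
    member : ∀ {z} → ∣ z ∣ ≤ M → z ∈ applyUpTo (_⊖ M) (suc (M + M))
    member {+ a} a≤M =
      subst (_∈ applyUpTo (_⊖ M) (suc (M + M)))
            (trans (ℤₚ.⊖-≥ (ℕₚ.m≤m+n M a)) (cong +_ (ℕₚ.m+n∸m≡n M a)))
            (∈ₚ.∈-applyUpTo⁺ (_⊖ M) (s≤s (ℕₚ.+-monoʳ-≤ M a≤M)))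
    member { -[1+ a ]} 1+a≤M =
      subst (_∈ applyUpTo (_⊖ M) (suc (M + M)))
            (trans (ℤₚ.⊖-≤ (ℕₚ.m∸n≤m M (suc a))) (cong (λ m → - (+ m)) (ℕₚ.m∸[m∸n]≡n 1+a≤M)))
            (∈ₚ.∈-applyUpTo⁺ (_⊖ M) (s≤s (ℕₚ.≤-trans (ℕₚ.m∸n≤m M (suc a)) (ℕₚ.m≤m+n M M))))

  sphere : ∀ s → Cover (λ z → ∣ z ∣ ≡ s) 2
  sphere s = cover (+ s ∷ - (+ s) ∷ []) ℕₚ.≤-refl member
    where
    member : ∀ {z} → ∣ z ∣ ≡ s → z ∈ + s ∷ - (+ s) ∷ []
    member {+ n}       refl = here refl
    member { -[1+ n ]} refl = there (here refl)

  BoundedList : ℕ → ℕ → List ℤ → Set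
  BoundedList M k l = length l ≡ k × All (λ z → ∣ z ∣ ≤ M) l

  box : ∀ M k → Cover (BoundedList M k) (suc (M + M) ^ k)
  box M zero    = cover ([] ∷ []) ℕₚ.≤-refl λ { {[]} _ → here refl }
  box M (suc k) = Cover-map (uncurry _∷_) preimage (Cover-× (interval M) (box M k))
    where
    preimage : ∀ {l} → BoundedList M (suc k) l → ∃ λ x → ((λ z → ∣ z ∣ ≤ M) ⟨×⟩ BoundedList M k) x × l ≡ uncurry _∷_ x
    preimage {z ∷ l} (len , z≤M ∷ l≤M) = (z , l) , (z≤M , ℕₚ.suc-injective len , l≤M) , refl

  BoundedList-applyUpTo : ∀ {M} (f : ℕ → ℤ) c → (∀ {x} → x < c → ∣ f x ∣ ≤ M) → BoundedList M c (applyUpTo f c)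
  BoundedList-applyUpTo f c bound = Listₚ.length-applyUpTo f c , Allₚ.applyUpTo⁺₁ f c bound

  HeadPair : (ℤ × ℤ → Set) → (List ℤ × List ℤ → Set) → List ℤ × List ℤ → Set
  HeadPair P Q (x ∷ xs , y ∷ ys) = P (x , y) × Q (xs , ys)
  HeadPair P Q _                 = ⊥

  Cover-HeadPair : ∀ {P Q N M} → Cover P N → Cover Q M → Cover (HeadPair P Q) (N * M)
  Cover-HeadPair {P} {Q} CP CQ = Cover-map (λ ((x , y) , (xs , ys)) → x ∷ xs , y ∷ ys) preimage (Cover-× CP CQ)
    where
    preimage : ∀ {c} → HeadPair P Q c → ∃ λ d → (P ⟨×⟩ Q) d × c ≡ _
    preimage {x ∷ xs , y ∷ ys} PQ = ((x , y) , (xs , ys)) , PQ , refl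

open Covers

module Estimates where

  open import Data.Nat using (_+_; _*_; _^_; NonZero)
  open import Data.Nat.DivMod using (_/_; m*n/n≡m; /-monoˡ-≤)
  open import Data.Nat.Tactic.RingSolver using (solve-∀)
  open ℕₚ.≤-Reasoning

  ∑-mono-const : ∀ K {X} (u : ℕ → ℕ) → (∀ k → k < K → u k ≤ X) → ∑[ k < K ] u k ≤ K * X
  ∑-mono-const zero    u u≤X = z≤n
  ∑-mono-const (suc K) {X} u u≤X = begin
    ∑[ k < K ] u k + u K ≤⟨ ℕₚ.+-mono-≤ (∑-mono-const K u (λ k k<K → u≤X k (ℕₚ.m≤n⇒m≤1+n k<K))) (u≤X K ℕₚ.≤-refl) ⟩
    K * X + X            ≡⟨ ℕₚ.+-comm (K * X) X ⟩
    suc K * X            ∎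

  -- Σ 1/((k+1)(k+2)) telescopes to at most 1.
  ∑-telescoping : ∀ K {A} (u : ℕ → ℕ) → (∀ k → k < K → u k * (suc k * suc (suc k)) ≤ A) → ∑[ k < K ] u k ≤ A
  ∑-telescoping K {A} u bound = ℕₚ.*-cancelˡ-≤ (suc K) (ℕₚ.≤-trans (weighted K bound) (ℕₚ.*-monoˡ-≤ A (ℕₚ.n≤1+n K)))
    where
    weighted : ∀ K → (∀ k → k < K → u k * (suc k * suc (suc k)) ≤ A) → suc K * ∑[ k < K ] u k ≤ K * A
    weighted zero    _     = z≤n
    weighted (suc K) bound = ℕₚ.*-cancelˡ-≤ (suc K) (begin
      suc K * (suc (suc K) * (S + u K))                        ≡⟨ lemma₁ K (u K) S ⟩
      u K * (suc K * suc (suc K)) + suc (suc K) * (suc K * S)  ≤⟨ ℕₚ.+-mono-≤ (bound K ℕₚ.≤-refl)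
                                                                    (ℕₚ.*-monoʳ-≤ (suc (suc K)) (weighted K (λ k k<K → bound k (ℕₚ.m≤n⇒m≤1+n k<K)))) ⟩
      A + suc (suc K) * (K * A)                                ≡⟨ lemma₂ K A ⟩
      suc K * (suc K * A)                                      ∎)
      where
      S = ∑[ k < K ] u k
      lemma₁ : ∀ K u S → suc K * (suc (suc K) * (S + u)) ≡ u * (suc K * suc (suc K)) + suc (suc K) * (suc K * S)
      lemma₁ = solve-∀
      lemma₂ : ∀ K A → A + suc (suc K) * (K * A) ≡ suc K * (suc K * A)
      lemma₂ = solve-∀

  ^-distribʳ-* : ∀ m n k → (m * n) ^ k ≡ m ^ k * n ^ k
  ^-distribʳ-* m n zero    = refl
  ^-distribʳ-* m n (suc k) = trans (cong (m * n *_) (^-distribʳ-* m n k)) (lemma m n (m ^ k) (n ^ k))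
    where
    lemma : ∀ m n x y → m * n * (x * y) ≡ m * x * (n * y)
    lemma = solve-∀

  private
    floor-cube-root : ∀ M → 1 ≤ M → ∃ λ i → 1 ≤ i × i ^ 3 ≤ M × M < suc i ^ 3
    floor-cube-root (suc zero)     _ = 1 , ℕₚ.≤-refl , ℕₚ.≤-refl , s≤s (s≤s z≤n)
    floor-cube-root (suc (suc M)) _ with floor-cube-root (suc M) (s≤s z≤n)
    ... | i , 1≤i , i³≤M , M<[1+i]³ with suc i ^ 3 ℕₚ.≤? suc (suc M)
    ...   | yes [1+i]³≤2+M = suc i , s≤s z≤n , [1+i]³≤2+M , ℕₚ.≤-<-trans M<[1+i]³ (ℕₚ.^-monoˡ-< 3 (ℕₚ.n<1+n (suc i)))
    ...   | no  [1+i]³≰2+M = i , 1≤i , ℕₚ.m≤n⇒m≤1+n i³≤M , ℕₚ.≰⇒> [1+i]³≰2+M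

  cube-root : ∀ M → 1 ≤ M → ∃ λ K → 1 ≤ K × M ≤ K ^ 3 × K ^ 3 ≤ 8 * M
  cube-root M 1≤M with floor-cube-root M 1≤M
  ... | i , 1≤i , i³≤M , M<[1+i]³ = suc i , s≤s z≤n , ℕₚ.<⇒≤ M<[1+i]³ , (begin
    suc i ^ 3     ≤⟨ ℕₚ.^-monoˡ-≤ 3 (ℕₚ.+-monoˡ-≤ i 1≤i) ⟩
    (i + i) ^ 3   ≡⟨ lemma i ⟩
    8 * i ^ 3     ≤⟨ ℕₚ.*-monoʳ-≤ 8 i³≤M ⟩
    8 * M         ∎)
    where
    lemma : ∀ i → (i + i) * ((i + i) * ((i + i) * 1)) ≡ 8 * (i * (i * (i * 1)))
    lemma = solve-∀

  max-pairs-size : ℕ → ℕ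
  max-pairs-size s = suc (s + s) * 2 + 2 * suc (s + s)

  linear-term-bound : ∀ j s w Q → 1 ≤ s → s * w ≤ Q →
                      max-pairs-size s * w ^ (3 + j) * (s * suc s) ≤ 24 * Q ^ (3 + j)
  linear-term-bound j (suc v) w Q _ sw≤Q = begin
    max-pairs-size s * w ^ (3 + j) * (s * suc s)   ≡⟨ lemma₁ (max-pairs-size s) w (w ^ j) s ⟩
    max-pairs-size s * (s * suc s) * (w ^ 3 * w ^ j) ≤⟨ ℕₚ.*-monoˡ-≤ _ size-bound ⟩
    24 * s ^ 3 * (w ^ 3 * w ^ j)              ≡⟨ lemma₂ s w (w ^ j) ⟩
    24 * ((s * w) ^ 3 * w ^ j)                ≤⟨ ℕₚ.*-monoʳ-≤ 24 (ℕₚ.*-mono-≤ (ℕₚ.^-monoˡ-≤ 3 sw≤Q) (ℕₚ.^-monoˡ-≤ j w≤Q)) ⟩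
    24 * (Q ^ 3 * Q ^ j)                      ≡⟨ cong (24 *_) (ℕₚ.^-distribˡ-+-* Q 3 j) ⟨
    24 * Q ^ (3 + j)                          ∎
    where
    s = suc v
    w≤Q : w ≤ Q
    w≤Q = ℕₚ.≤-trans (ℕₚ.m≤n*m w s) sw≤Q
    size-bound : max-pairs-size s * (s * suc s) ≤ 24 * s ^ 3
    size-bound = subst (max-pairs-size s * (s * suc s) ≤_) (sym (lemma₃ v)) (ℕₚ.m≤m+n _ _)
      where
      lemma₃ : ∀ v → 24 * ((1 + v) * ((1 + v) * ((1 + v) * 1)))
                     ≡ (suc (suc v + suc v) * 2 + 2 * suc (suc v + suc v)) * (suc v * suc (suc v))
                       + 4 * (suc v * ((5 + 4 * v) * v))
      lemma₃ = solve-∀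
    lemma₁ : ∀ r w W s → r * (w * (w * (w * W))) * (s * (1 + s)) ≡ r * (s * (1 + s)) * (w * (w * (w * 1)) * W)
    lemma₁ = solve-∀
    lemma₂ : ∀ s w W → 24 * (s * (s * (s * 1))) * (w * (w * (w * 1)) * W) ≡ 24 * ((s * w) * ((s * w) * ((s * w) * 1)) * W)
    lemma₂ = solve-∀

  wide-term-bound : ∀ j K X → K ^ 3 ≤ X →
    27 * (K * K ^ 3) * (27 * (K * K ^ 3) * (27 * (K * K ^ 3) * (3 * K ^ 3) ^ j)) ≤ 19683 * 3 ^ j * X ^ (4 + j)
  wide-term-bound j K X K³≤X = begin
    W * (W * (W * (3 * L) ^ j))          ≡⟨ cong (λ y → W * (W * (W * y))) (^-distribʳ-* 3 L j) ⟩
    W * (W * (W * (3 ^ j * L ^ j)))      ≡⟨ lemma K (3 ^ j) (L ^ j) ⟩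
    19683 * 3 ^ j * (L ^ 4 * L ^ j)      ≡⟨ cong (19683 * 3 ^ j *_) (ℕₚ.^-distribˡ-+-* L 4 j) ⟨
    19683 * 3 ^ j * L ^ (4 + j)          ≤⟨ ℕₚ.*-monoʳ-≤ (19683 * 3 ^ j) (ℕₚ.^-monoˡ-≤ (4 + j) K³≤X) ⟩
    19683 * 3 ^ j * X ^ (4 + j)          ∎
    where
    L = K ^ 3
    W = 27 * (K * L)
    lemma : ∀ K A B → 27 * (K * (K * (K * (K * 1)))) * (27 * (K * (K * (K * (K * 1)))) * (27 * (K * (K * (K * (K * 1)))) * (A * B)))
                      ≡ 19683 * A * ((K * (K * (K * 1))) * ((K * (K * (K * 1))) * ((K * (K * (K * 1))) * ((K * (K * (K * 1))) * 1))) * B)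
    lemma = solve-∀

  lower-count : ∀ j T → 1 ≤ T → suc T ^ (3 + j) ≤ T * suc (T + T) ^ (2 + j)
  lower-count j (suc u) _ = begin
    suc T ^ (3 + j)                   ≡⟨ ℕₚ.^-distribˡ-+-* (suc T) 3 j ⟩
    suc T ^ 3 * suc T ^ j             ≤⟨ ℕₚ.*-mono-≤ cube-bound (ℕₚ.^-monoˡ-≤ j (s≤s (ℕₚ.m≤n+m T T))) ⟩
    T * B ^ 2 * B ^ j                 ≡⟨ ℕₚ.*-assoc T (B ^ 2) (B ^ j) ⟩
    T * (B ^ 2 * B ^ j)               ≡⟨ cong (T *_) (ℕₚ.^-distribˡ-+-* B 2 j) ⟨
    T * B ^ (2 + j)                   ∎
    where
    T = suc u
    B = suc (T + T)
    cube-bound : suc T ^ 3 ≤ T * B ^ 2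
    cube-bound = subst (suc T ^ 3 ≤_) (lemma u) (ℕₚ.m≤m+n _ _)
      where
      lemma : ∀ u → suc (suc u) * (suc (suc u) * (suc (suc u) * 1)) + (3 * (u * u * u) + 10 * (u * u) + 9 * u + 1)
                    ≡ suc u * (suc (suc u + suc u) * (suc (suc u + suc u) * 1))
      lemma = solve-∀

  suc[m+m]≤3m : ∀ {m} → 1 ≤ m → suc (m + m) ≤ 3 * m
  suc[m+m]≤3m {m} 1≤m = ℕₚ.≤-trans (ℕₚ.+-monoˡ-≤ (m + m) 1≤m) (ℕₚ.≤-reflexive (lemma m))
    where
    lemma : ∀ m → m + (m + m) ≡ 3 * m
    lemma = solve-∀

  ≤/ : ∀ {m n o} .{{_ : NonZero n}} → n * m ≤ o → m ≤ o / n
  ≤/ {m} {n} {o} nm≤o = begin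
    m                ≡⟨ m*n/n≡m m n ⟨
    m * n / n        ≤⟨ /-monoˡ-≤ n (subst (_≤ o) (ℕₚ.*-comm n m) nm≤o) ⟩
    o / n            ∎

open Estimates

module UpperBound where

  open import Data.Nat using (_+_; _*_; _^_; NonZero; >-nonZero)
  open import Data.Nat.DivMod using (_/_; m/n*n≤m)
  open import Data.Nat.Tactic.RingSolver using (solve-∀)
  open import Data.List.Relation.Unary.All using (All; []; _∷_)

  All-coeff : ∀ {P : ℤ → Set} l → (∀ k → P (coeff l k)) → All P l
  All-coeff []      _ = []
  All-coeff (a ∷ l) h = h 0 ∷ All-coeff l (h ∘ suc)

  coeff-toList-≤ : ∀ {n T} (v : Vec ℤ n) → (∀ i → ∣ lookup v i ∣ ≤ T) → ∀ k → ∣ coeff (toList v) k ∣ ≤ T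
  coeff-toList-≤ []      _      k       = z≤n
  coeff-toList-≤ (a ∷ v) height zero    = height zero
  coeff-toList-≤ (a ∷ v) height (suc k) = coeff-toList-≤ v (height ∘ suc) k

  ∣eval∣≤ : ∀ l x {T} → (∀ k → ∣ coeff l k ∣ ≤ T) → ∣ eval l (+ x) ∣ ≤ T * suc x ^ length l
  ∣eval∣≤ []      x         height = z≤n
  ∣eval∣≤ (a ∷ l) x {T} height = begin
    ∣ a ℤ.+ + x ℤ.* eval l (+ x) ∣          ≤⟨ ℤₚ.∣i+j∣≤∣i∣+∣j∣ a _ ⟩
    ∣ a ∣ + ∣ + x ℤ.* eval l (+ x) ∣        ≡⟨ cong (_+_ ∣ a ∣) (ℤₚ.abs-* (+ x) _) ⟩
    ∣ a ∣ + x * ∣ eval l (+ x) ∣            ≤⟨ ℕₚ.+-mono-≤ (height 0) (ℕₚ.*-monoʳ-≤ x (∣eval∣≤ l x (height ∘ suc))) ⟩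
    T + x * (T * X)                        ≤⟨ ℕₚ.+-monoˡ-≤ _ (ℕₚ.m≤m*n T X {{ℕₚ.m^n≢0 (suc x) (length l)}}) ⟩
    T * X + x * (T * X)                    ≡⟨ lemma T X x ⟩
    T * (suc x * X)                        ∎
    where
    open ℕₚ.≤-Reasoning
    X = suc x ^ length l
    lemma : ∀ T X x → T * X + x * (T * X) ≡ T * (suc x * X)
    lemma = solve-∀

  ∣eval-toList∣≤ : ∀ {n T} (p : Vec ℤ (suc n)) → (∀ i → ∣ lookup p i ∣ ≤ T) →
                   ∀ x → x ≤ n → ∣ eval (toList p) (+ x) ∣ ≤ T * suc n ^ suc n
  ∣eval-toList∣≤ {n} {T} p height x x≤n = begin
    ∣ eval (toList p) (+ x) ∣        ≤⟨ ∣eval∣≤ (toList p) x (coeff-toList-≤ p height) ⟩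
    T * suc x ^ length (toList p)    ≡⟨ cong (λ m → T * suc x ^ m) (Vecₚ.length-toList p) ⟩
    T * suc x ^ suc n                ≤⟨ ℕₚ.*-monoʳ-≤ T (ℕₚ.^-monoˡ-≤ (suc n) (s≤s x≤n)) ⟩
    T * suc n ^ suc n                ∎
    where open ℕₚ.≤-Reasoning

  max-pairs : ∀ s → Cover (λ (c₀ , c₁) → ∣ c₀ ∣ ⊔ ∣ c₁ ∣ ≡ s) (max-pairs-size s)
  max-pairs s = Cover-⊆ (λ {c} → split {proj₁ c} {proj₂ c})
                   (Cover-∪ (Cover-× (interval s) (sphere s)) (Cover-× (sphere s) (interval s)))
    where
    split : ∀ {c₀ c₁} → ∣ c₀ ∣ ⊔ ∣ c₁ ∣ ≡ s → (∣ c₀ ∣ ≤ s × ∣ c₁ ∣ ≡ s) ⊎ (∣ c₀ ∣ ≡ s × ∣ c₁ ∣ ≤ s)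
    split {c₀} {c₁} refl with ∣ c₁ ∣ ℕₚ.≤? ∣ c₀ ∣
    ... | yes c₁≤c₀ = inj₂ (sym (ℕₚ.m≥n⇒m⊔n≡m c₁≤c₀) , ℕₚ.m≤n⊔m ∣ c₀ ∣ ∣ c₁ ∣)
    ... | no  c₁≰c₀ = inj₁ (ℕₚ.m≤m⊔n ∣ c₀ ∣ ∣ c₁ ∣ , sym (ℕₚ.m≤n⇒m⊔n≡n (ℕₚ.<⇒≤ (ℕₚ.≰⇒> c₁≰c₀))))

  ScaledLinearCode : (n T s : ℕ) → .{{NonZero s}} → ℤ × ℤ × List ℤ → Set
  ScaledLinearCode n T s (c₀ , c₁ , g) = ∣ c₀ ∣ ⊔ ∣ c₁ ∣ ≡ s × BoundedList ((n * T) / s) n g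

  LinearCode : (n T : ℕ) → ℤ × ℤ × List ℤ → Set
  LinearCode n T c = ∃ λ k → k < n * T × ScaledLinearCode n T (suc k) c

  linear-constant : ℕ → ℕ
  linear-constant n = 24 * (3 * n) ^ n

  linear-codes : ∀ j T → Cover (LinearCode (3 + j) T) (linear-constant (3 + j) * T ^ (3 + j))
  linear-codes j T = Cover-≤ (ℕₚ.≤-trans (∑-telescoping (n * T) _ term-bound) (ℕₚ.≤-reflexive rearrange))
                             (Cover-⋃ scaled (n * T))
    where
    n = 3 + j
    D : ℕ → ℕ
    D k = (n * T) / suc k
    scaled : ∀ k → Cover (ScaledLinearCode n T (suc k)) (max-pairs-size (suc k) * suc (D k + D k) ^ n)
    scaled k = Cover-map (λ ((c₀ , c₁) , g) → c₀ , c₁ , g)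
                         (λ {(c₀ , c₁ , g)} code → ((c₀ , c₁) , g) , code , refl)
                         (Cover-× (max-pairs (suc k)) (box (D k) n))
    term-bound : ∀ k → k < n * T → max-pairs-size (suc k) * suc (D k + D k) ^ n * (suc k * suc (suc k)) ≤ 24 * (3 * (n * T)) ^ n
    term-bound k k<nT = linear-term-bound j (suc k) (suc (D k + D k)) (3 * (n * T)) (s≤s z≤n) (begin
      suc k * suc (D k + D k)                 ≡⟨ lemma (suc k) (D k) ⟩
      suc k + (suc k * D k + suc k * D k)     ≤⟨ ℕₚ.+-mono-≤ k<nT (ℕₚ.+-mono-≤ sD≤nT sD≤nT) ⟩
      n * T + (n * T + n * T)                 ≡⟨ lemma′ (n * T) ⟩
      3 * (n * T)                             ∎)
      where
      open ℕₚ.≤-Reasoning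
      sD≤nT : suc k * D k ≤ n * T
      sD≤nT = ℕₚ.≤-trans (ℕₚ.≤-reflexive (ℕₚ.*-comm (suc k) (D k))) (m/n*n≤m (n * T) (suc k))
      lemma : ∀ s D → s * suc (D + D) ≡ s + (s * D + s * D)
      lemma = solve-∀
      lemma′ : ∀ x → x + (x + x) ≡ 3 * x
      lemma′ = solve-∀
    rearrange : 24 * (3 * (n * T)) ^ n ≡ linear-constant n * T ^ n
    rearrange = trans (cong (λ x → 24 * x ^ n) (sym (ℕₚ.*-assoc 3 n T)))
                      (trans (cong (24 *_) (^-distribʳ-* (3 * n) T n)) (sym (ℕₚ.*-assoc 24 ((3 * n) ^ n) (T ^ n))))

  SmallPair : ℕ → ℤ × ℤ → Set
  SmallPair L (x , y) = ∣ x ∣ ≤ L × ∣ y ∣ ≤ L × ∣ x ∣ * ∣ y ∣ ≤ L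

  i*j≢0⇒i≢0×j≢0 : ∀ i j → i ℤ.* j ≢ 0ℤ → i ≢ 0ℤ × j ≢ 0ℤ
  i*j≢0⇒i≢0×j≢0 i j ij≢0 = (λ i≡0 → ij≢0 (trans (cong (ℤ._* j) i≡0) (ℤₚ.*-zeroˡ j))) ,
                           (λ j≡0 → ij≢0 (trans (cong (i ℤ.*_) j≡0) (ℤₚ.*-zeroʳ i)))

  i≢0⇒∣i∣>0 : ∀ {i} → i ≢ 0ℤ → 0 < ∣ i ∣
  i≢0⇒∣i∣>0 {i} i≢0 = ℕₚ.n≢0⇒n>0 (i≢0 ∘ ℤₚ.∣i∣≡0⇒i≡0 {i})

  SmallPair-factors : ∀ {L} x y → x ℤ.* y ≢ 0ℤ → ∣ x ℤ.* y ∣ ≤ L → SmallPair L (x , y)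
  SmallPair-factors {L} x y xy≢0 ∣xy∣≤L =
    ℕₚ.≤-trans (ℕₚ.m≤m*n ∣ x ∣ ∣ y ∣ {{ℤ.≢-nonZero (proj₂ (i*j≢0⇒i≢0×j≢0 x y xy≢0))}}) ∣x∣∣y∣≤L ,
    ℕₚ.≤-trans (ℕₚ.m≤n*m ∣ y ∣ ∣ x ∣ {{ℤ.≢-nonZero (proj₁ (i*j≢0⇒i≢0×j≢0 x y xy≢0))}}) ∣x∣∣y∣≤L ,
    ∣x∣∣y∣≤L
    where
    ∣x∣∣y∣≤L : ∣ x ∣ * ∣ y ∣ ≤ L
    ∣x∣∣y∣≤L = subst (_≤ L) (ℤₚ.abs-* x y) ∣xy∣≤L

  -- Either |x| ≤ K, or |y| ≤ K, or else both are at most K².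
  small-pairs : ∀ K → 1 ≤ K → Cover (SmallPair (K ^ 3)) (27 * (K * K ^ 3))
  small-pairs K 1≤K = Cover-≤ size (Cover-⊆ (λ {c} → split {proj₁ c} {proj₂ c})
    (Cover-∪ (Cover-× (interval K) (interval (K ^ 3)))
    (Cover-∪ (Cover-× (interval (K ^ 3)) (interval K)) (Cover-× (interval (K ^ 2)) (interval (K ^ 2))))))
    where
    split : ∀ {x y} → SmallPair (K ^ 3) (x , y) →
            (∣ x ∣ ≤ K × ∣ y ∣ ≤ K ^ 3) ⊎ (∣ x ∣ ≤ K ^ 3 × ∣ y ∣ ≤ K) ⊎ (∣ x ∣ ≤ K ^ 2 × ∣ y ∣ ≤ K ^ 2)
    split {x} {y} (x≤L , y≤L , xy≤L) with ∣ x ∣ ℕₚ.≤? K | ∣ y ∣ ℕₚ.≤? K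
    ... | yes x≤K | _       = inj₁ (x≤K , y≤L)
    ... | no  _   | yes y≤K = inj₂ (inj₁ (x≤L , y≤K))
    ... | no  x≰K | no  y≰K = inj₂ (inj₂ (≤K² (ℕₚ.<⇒≤ (ℕₚ.≰⇒> y≰K)) xy≤L ,
                                          ≤K² (ℕₚ.<⇒≤ (ℕₚ.≰⇒> x≰K)) (subst (_≤ K ^ 3) (ℕₚ.*-comm ∣ x ∣ ∣ y ∣) xy≤L)))
      where
      instance _ = >-nonZero 1≤K
      ≤K² : ∀ {a b} → K ≤ b → a * b ≤ K ^ 3 → a ≤ K ^ 2
      ≤K² {a} {b} K≤b ab≤K³ = ℕₚ.*-cancelˡ-≤ K (ℕₚ.≤-trans (ℕₚ.≤-reflexive (ℕₚ.*-comm K a))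
                                                  (ℕₚ.≤-trans (ℕₚ.*-monoʳ-≤ a K≤b) ab≤K³))
    size : suc (K + K) * suc (K ^ 3 + K ^ 3) + (suc (K ^ 3 + K ^ 3) * suc (K + K) + suc (K ^ 2 + K ^ 2) * suc (K ^ 2 + K ^ 2))
           ≤ 27 * (K * K ^ 3)
    size = begin
      suc (K + K) * suc (K ^ 3 + K ^ 3) + (suc (K ^ 3 + K ^ 3) * suc (K + K) + suc (K ^ 2 + K ^ 2) * suc (K ^ 2 + K ^ 2))
        ≤⟨ ℕₚ.+-mono-≤ (ℕₚ.*-mono-≤ b₁ b₃) (ℕₚ.+-mono-≤ (ℕₚ.*-mono-≤ b₃ b₁) (ℕₚ.*-mono-≤ b₂ b₂)) ⟩
      3 * K * (3 * K ^ 3) + (3 * K ^ 3 * (3 * K) + 3 * K ^ 2 * (3 * K ^ 2))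
        ≡⟨ lemma K ⟩
      27 * (K * K ^ 3) ∎
      where
      open ℕₚ.≤-Reasoning
      b₁ = suc[m+m]≤3m 1≤K
      b₂ = suc[m+m]≤3m (ℕₚ.^-monoˡ-≤ 2 1≤K)
      b₃ = suc[m+m]≤3m (ℕₚ.^-monoˡ-≤ 3 1≤K)
      lemma : ∀ K → 3 * K * (3 * (K * (K * (K * 1)))) + (3 * (K * (K * (K * 1))) * (3 * K) + 3 * (K * (K * 1)) * (3 * (K * (K * 1))))
                    ≡ 27 * (K * (K * (K * (K * 1))))
      lemma = solve-∀

  -- The pairs (q(x), r(x)) for x = 0, 1, 2, then q(3), …, q(2 + a) and r(3), …, r(2 + b),
  -- where a + b = j − 1.
  WideCode : (K j : ℕ) → List ℤ × List ℤ → Set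
  WideCode K j c = ∃ λ a → a < j × HeadPair (SmallPair (K ^ 3)) (HeadPair (SmallPair (K ^ 3)) (HeadPair (SmallPair (K ^ 3))
                     (BoundedList (K ^ 3) a ⟨×⟩ BoundedList (K ^ 3) (j ∸ 1 ∸ a)))) c

  wide-size : ℕ → ℕ → ℕ
  wide-size K j = j * (27 * (K * K ^ 3) * (27 * (K * K ^ 3) * (27 * (K * K ^ 3) * (3 * K ^ 3) ^ (j ∸ 1))))

  wide-codes : ∀ K j → 1 ≤ K → Cover (WideCode K j) (wide-size K j)
  wide-codes K j 1≤K = Cover-≤ (∑-mono-const j _ term-bound) (Cover-⋃ per-degree j)
    where
    W = 27 * (K * K ^ 3)
    B = suc (K ^ 3 + K ^ 3)
    per-degree : ∀ a → Cover _ (W * (W * (W * (B ^ a * B ^ (j ∸ 1 ∸ a)))))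
    per-degree a = Cover-HeadPair (small-pairs K 1≤K) (Cover-HeadPair (small-pairs K 1≤K) (Cover-HeadPair (small-pairs K 1≤K)
                     (Cover-× (box (K ^ 3) a) (box (K ^ 3) (j ∸ 1 ∸ a)))))
    term-bound : ∀ a → a < j → W * (W * (W * (B ^ a * B ^ (j ∸ 1 ∸ a)))) ≤ W * (W * (W * (3 * K ^ 3) ^ (j ∸ 1)))
    term-bound a a<j = ℕₚ.*-monoʳ-≤ W (ℕₚ.*-monoʳ-≤ W (ℕₚ.*-monoʳ-≤ W (begin
      B ^ a * B ^ (j ∸ 1 ∸ a)   ≡⟨ ℕₚ.^-distribˡ-+-* B a (j ∸ 1 ∸ a) ⟨
      B ^ (a + (j ∸ 1 ∸ a))     ≡⟨ cong (B ^_) (ℕₚ.m+[n∸m]≡n (ℕₚ.∸-monoˡ-≤ 1 a<j)) ⟩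
      B ^ (j ∸ 1)               ≤⟨ ℕₚ.^-monoˡ-≤ (j ∸ 1) (suc[m+m]≤3m (ℕₚ.^-monoˡ-≤ 3 1≤K)) ⟩
      (3 * K ^ 3) ^ (j ∸ 1)     ∎)))
      where open ℕₚ.≤-Reasoning

  module _ (j T : ℕ) where

    linear-code : ∀ (p : Vec ℤ (suc (3 + j))) → InRℕ (3 + j) T p → ∀ c₀ c₁ (g : Vec ℤ (3 + j)) →
                  toList p ≈ linear c₀ c₁ ⊛ toList g → LinearCode (3 + j) T (c₀ , c₁ , toList g)
    linear-code p (lead≢0 , height , _) c₀ c₁ g p≈ =
      scaled (∣ c₀ ∣ ⊔ ∣ c₁ ∣) refl (ℕₚ.≤-trans (i≢0⇒∣i∣>0 c₁≢0) (ℕₚ.m≤n⊔m ∣ c₀ ∣ ∣ c₁ ∣))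
      where
      G = coeff (toList g)
      bound : ∀ k → (∣ c₀ ∣ ⊔ ∣ c₁ ∣) * ∣ G k ∣ ≤ (3 + j) * T
      bound = linear-factor-bound c₀ c₁ (toList g) (toList p) (Degree<-toList g) (coeff-toList-≤ p height) p≈
      top : coeff (toList p) (3 + j) ≡ c₁ ℤ.* G (2 + j)
      top = begin
        coeff (toList p) (3 + j)                 ≡⟨ p≈ (3 + j) ⟩
        coeff (linear c₀ c₁ ⊛ toList g) (3 + j)  ≡⟨ coeff-linear-⊛-suc c₀ c₁ (toList g) (2 + j) ⟩
        c₀ ℤ.* G (3 + j) ℤ.+ c₁ ℤ.* G (2 + j)    ≡⟨ cong (λ z → c₀ ℤ.* z ℤ.+ c₁ ℤ.* G (2 + j)) (Degree<-toList g (3 + j) ℕₚ.≤-refl) ⟩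
        c₀ ℤ.* 0ℤ ℤ.+ c₁ ℤ.* G (2 + j)           ≡⟨ cong (ℤ._+ c₁ ℤ.* G (2 + j)) (ℤₚ.*-zeroʳ c₀) ⟩
        0ℤ ℤ.+ c₁ ℤ.* G (2 + j)                  ≡⟨ ℤₚ.+-identityˡ _ ⟩
        c₁ ℤ.* G (2 + j)                         ∎
        where open ≡-Reasoning
      c₁≢0 : c₁ ≢ 0ℤ
      c₁≢0 = proj₁ (i*j≢0⇒i≢0×j≢0 c₁ (G (2 + j)) (proj₁ (HasDegree-toList p lead≢0) ∘ trans top))
      G≢0 : G (2 + j) ≢ 0ℤ
      G≢0 = proj₂ (i*j≢0⇒i≢0×j≢0 c₁ (G (2 + j)) (proj₁ (HasDegree-toList p lead≢0) ∘ trans top))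
      scaled : ∀ s → ∣ c₀ ∣ ⊔ ∣ c₁ ∣ ≡ s → 1 ≤ s → LinearCode (3 + j) T (c₀ , c₁ , toList g)
      scaled (suc k) s≡1+k _ = k , k<nT , s≡1+k , Vecₚ.length-toList g , All-coeff (toList g) (λ i → ≤/ (bound′ i))
        where
        bound′ : ∀ i → suc k * ∣ G i ∣ ≤ (3 + j) * T
        bound′ i = subst (λ s → s * ∣ G i ∣ ≤ (3 + j) * T) s≡1+k (bound i)
        k<nT : suc k ≤ (3 + j) * T
        k<nT = ℕₚ.≤-trans (ℕₚ.m≤m*n (suc k) ∣ G (2 + j) ∣ {{ℤ.≢-nonZero G≢0}}) (bound′ (2 + j))

    wide-code : ∀ {K} (p : Vec ℤ (suc (3 + j))) → InRℕ (3 + j) T p → T * suc (3 + j) ^ suc (3 + j) ≤ K ^ 3 →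
                (w : WideFactorisation p) → WideCode K j (valueCode w)
    wide-code {K} p (_ , height , _) Tc≤K³ w =
      a , a<j , small 0 z≤n , small 1 (s≤s z≤n) , small 2 (s≤s (s≤s z≤n)) ,
      BoundedList-applyUpTo _ a (λ x<a → proj₁ (small _ (in-range a<j x<a))) ,
      subst (λ c → BoundedList (K ^ 3) c (applyUpTo (λ x → eval r (+ (3 + x))) b)) (sym j∸1∸a≡b)
            (BoundedList-applyUpTo _ b (λ x<b → proj₁ (proj₂ (small _ (in-range b<j x<b)))))
      where
      open WideFactorisation w
      a+b+1≡j : suc (a + b) ≡ j
      a+b+1≡j = ℕₚ.suc-injective (ℕₚ.suc-injective (ℕₚ.suc-injective degree-sum))
      a<j : a < j
      a<j = subst (a <_) a+b+1≡j (s≤s (ℕₚ.m≤m+n a b))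
      b<j : b < j
      b<j = subst (b <_) a+b+1≡j (s≤s (ℕₚ.m≤n+m b a))
      j∸1∸a≡b : j ∸ 1 ∸ a ≡ b
      j∸1∸a≡b = trans (cong (λ m → m ∸ 1 ∸ a) (sym a+b+1≡j)) (ℕₚ.m+n∸m≡n a b)
      in-range : ∀ {c x} → c < j → x < c → 3 + x ≤ 3 + j
      in-range c<j x<c = ℕₚ.+-monoʳ-≤ 3 (ℕₚ.<⇒≤ (ℕₚ.<-trans x<c c<j))
      small : ∀ x → x ≤ 3 + j → SmallPair (K ^ 3) (eval q (+ x) , eval r (+ x))
      small x x≤n = SmallPair-factors (eval q (+ x)) (eval r (+ x)) (no-root x x≤n ∘ trans p≡qr)
        (subst (λ z → ∣ z ∣ ≤ K ^ 3) p≡qr (ℕₚ.≤-trans (∣eval-toList∣≤ p height x x≤n) Tc≤K³))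
        where
        p≡qr : eval (toList p) (+ x) ≡ eval q (+ x) ℤ.* eval r (+ x)
        p≡qr = trans (eval-cong (toList p) (q ⊛ r) (+ x) factors) (eval-⊛ q r (+ x))

    GoodCode : ℕ → Code → Set
    GoodCode K = LinearCode (3 + j) T ⟨⊎⟩ WideCode K j

    code-of : ∀ {K} → T * suc (3 + j) ^ suc (3 + j) ≤ K ^ 3 → ∀ p → InRℕ (3 + j) T p → Σ Code λ c → Decodes p c × GoodCode K c
    code-of {K} Tc≤K³ p inR@(lead≢0 , _ , red) with reducible-cases p lead≢0 red
    ... | inj₁ (c₀ , c₁ , g , p≈) = inj₁ (c₀ , c₁ , toList g) , p≈ , linear-code p inR c₀ c₁ g p≈
    ... | inj₂ w                  = inj₂ (valueCode w) , (w , refl) , wide-code {K} p inR Tc≤K³ w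

    count-by-codes : ∀ {K} → 1 ≤ K → T * suc (3 + j) ^ suc (3 + j) ≤ K ^ 3 →
      ∀ {m} (f : Fin m → Vec ℤ (suc (3 + j))) → Injective _≡_ _≡_ f → (∀ i → InRℕ (3 + j) T (f i)) →
      m ≤ linear-constant (3 + j) * T ^ (3 + j) + wide-size K j
    count-by-codes {K} 1≤K Tc≤K³ f f-injective inR =
      count≤ (Cover-⊎ (linear-codes j T) (wide-codes K j 1≤K)) code code-injective (λ i → proj₂ (proj₂ (classified i)))
      where
      classified : ∀ i → Σ Code λ c → Decodes (f i) c × GoodCode K c
      classified i = code-of {K} Tc≤K³ (f i) (inR i)
      code : Fin _ → Code
      code i = proj₁ (classified i)
      code-injective : Injective _≡_ _≡_ code
      code-injective {i} {i′} same = f-injective (decode-unique (f i) (f i′) (code i′)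
        (subst (Decodes (f i)) same (proj₁ (proj₂ (classified i)))) (proj₁ (proj₂ (classified i′))))

  wide-constant : ℕ → ℕ
  wide-constant j = j * (19683 * 3 ^ (j ∸ 1) * (8 * suc (3 + j) ^ suc (3 + j)) ^ (3 + j))

  wide-size≤ : ∀ j K T → K ^ 3 ≤ 8 * (T * suc (3 + j) ^ suc (3 + j)) → wide-size K j ≤ wide-constant j * T ^ (3 + j)
  wide-size≤ zero    K T _      = z≤n
  wide-size≤ (suc j) K T K³≤8Tc = begin
    suc j * (27 * (K * K ^ 3) * (27 * (K * K ^ 3) * (27 * (K * K ^ 3) * (3 * K ^ 3) ^ j)))
      ≤⟨ ℕₚ.*-monoʳ-≤ (suc j) (wide-term-bound j K (8 * (T * c)) K³≤8Tc) ⟩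
    suc j * (19683 * 3 ^ j * (8 * (T * c)) ^ n)
      ≡⟨ cong (λ x → suc j * (19683 * 3 ^ j * x ^ n)) (lemma₁ T c) ⟩
    suc j * (19683 * 3 ^ j * (8 * c * T) ^ n)
      ≡⟨ cong (λ x → suc j * (19683 * 3 ^ j * x)) (^-distribʳ-* (8 * c) T n) ⟩
    suc j * (19683 * 3 ^ j * ((8 * c) ^ n * T ^ n))
      ≡⟨ lemma₂ (suc j) (19683 * 3 ^ j) ((8 * c) ^ n) (T ^ n) ⟩
    suc j * (19683 * 3 ^ j * (8 * c) ^ n) * T ^ n ∎
    where
    open ℕₚ.≤-Reasoning
    n = 3 + suc j
    c = suc n ^ suc n
    lemma₁ : ∀ T c → 8 * (T * c) ≡ 8 * c * T
    lemma₁ = solve-∀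
    lemma₂ : ∀ j A B C → j * (A * (B * C)) ≡ j * (A * B) * C
    lemma₂ = solve-∀

  upper-constant : ℕ → ℕ
  upper-constant j = linear-constant (3 + j) + wide-constant j

  -- The constant is the right factor: ℕ's _*_ recurses on its left argument, so Agda would
  -- otherwise unfold the (huge) constant when comparing terms.
  upper-bound : ∀ j T → 1 ≤ T → ∀ {m} (f : Fin m → Vec ℤ (suc (3 + j))) → Injective _≡_ _≡_ f →
                (∀ i → InRℕ (3 + j) T (f i)) → m ≤ T ^ (3 + j) * upper-constant j
  upper-bound j T 1≤T {m} f f-injective inR =
    let K , 1≤K , Tc≤K³ , K³≤8Tc = cube-root (T * suc (3 + j) ^ suc (3 + j))
                                             (ℕₚ.*-mono-≤ 1≤T (ℕₚ.m^n>0 (suc (3 + j)) (suc (3 + j))))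
    in begin
    m                                                                      ≤⟨ count-by-codes j T 1≤K Tc≤K³ f f-injective inR ⟩
    linear-constant (3 + j) * T ^ (3 + j) + wide-size K j                  ≤⟨ ℕₚ.+-monoʳ-≤ _ (wide-size≤ j K T K³≤8Tc) ⟩
    linear-constant (3 + j) * T ^ (3 + j) + wide-constant j * T ^ (3 + j)  ≡⟨ ℕₚ.*-distribʳ-+ (T ^ (3 + j)) (linear-constant (3 + j)) (wide-constant j) ⟨
    (linear-constant (3 + j) + wide-constant j) * T ^ (3 + j)              ≡⟨ ℕₚ.*-comm (linear-constant (3 + j) + wide-constant j) (T ^ (3 + j)) ⟩
    T ^ (3 + j) * upper-constant j                                         ∎
    where open ℕₚ.≤-Reasoning

open UpperBound

module LowerBound where

  open import Data.Nat using (_+_; _*_; _^_)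
  open import Data.Fin using (remQuot; combine; finToFun; funToFin)
  open import Data.Vec using (_∷ʳ_; tabulate; replicate)
  open import Data.Vec.Relation.Unary.All using (All; []; _∷_)
  import Data.Vec.Relation.Unary.All.Properties as Allₚ

  lookup-∷ʳ-fromℕ : ∀ {A : Set} {m} (v : Vec A m) x → lookup (v ∷ʳ x) (fromℕ m) ≡ x
  lookup-∷ʳ-fromℕ []      x = refl
  lookup-∷ʳ-fromℕ (y ∷ v) x = lookup-∷ʳ-fromℕ v x

  All-∷ʳ : ∀ {A : Set} {P : A → Set} {m} {v : Vec A m} {x} → All P v → P x → All P (v ∷ʳ x)
  All-∷ʳ []         px = px ∷ []
  All-∷ʳ (py ∷ pys) px = py ∷ All-∷ʳ pys px

  funToFin-cong : ∀ {m n} {φ ψ : Fin m → Fin n} → (∀ x → φ x ≡ ψ x) → funToFin φ ≡ funToFin ψ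
  funToFin-cong {zero}  φ≗ψ = refl
  funToFin-cong {suc m} φ≗ψ = cong₂ combine (φ≗ψ zero) (funToFin-cong (φ≗ψ ∘ suc))

  ⊖-injectiveˡ : ∀ {a b} T → a ⊖ T ≡ b ⊖ T → a ≡ b
  ⊖-injectiveˡ {a} {b} T eq = ℤₚ.+-injective (+-cancelʳ (ℤ.- + T) (+ a) (+ b)
    (trans (ℤₚ.m-n≡m⊖n a T) (trans eq (sym (ℤₚ.m-n≡m⊖n b T)))))

  ∣⊖∣≤ : ∀ {a} T → a ≤ T + T → ∣ a ⊖ T ∣ ≤ T
  ∣⊖∣≤ {a} T a≤2T with a ℕₚ.≤? T
  ... | yes a≤T = subst (_≤ T) (sym (ℤₚ.∣⊖∣-≤ a≤T)) (ℕₚ.m∸n≤m T a)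
  ... | no  a≰T = subst (_≤ T) (sym (trans (ℤₚ.∣m⊖n∣≡∣n⊖m∣ a T) (ℤₚ.∣⊖∣-≤ (ℕₚ.<⇒≤ (ℕₚ.≰⇒> a≰T)))))
                        (ℕₚ.m≤n+o⇒m∸n≤o a T a≤2T)

  coeff-replicate-0 : ∀ k i → coeff (toList (replicate k 0ℤ)) i ≡ 0ℤ
  coeff-replicate-0 zero    i       = refl
  coeff-replicate-0 (suc k) zero    = refl
  coeff-replicate-0 (suc k) (suc i) = coeff-replicate-0 k i

  module _ (j T : ℕ) where

    private
      n m B : ℕ
      n = 3 + j
      m = 2 + j
      B = suc (T + T)

    cofactor : Fin T → (Fin m → Fin B) → Vec ℤ n
    cofactor t φ = tabulate (λ x → toℕ (φ x) ⊖ T) ∷ʳ + suc (toℕ t)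

    multiple-of-X : Fin T → (Fin m → Fin B) → Vec ℤ (suc n)
    multiple-of-X t φ = 0ℤ ∷ cofactor t φ

    multiple-of-X-injective : ∀ {t t′ φ ψ} → multiple-of-X t φ ≡ multiple-of-X t′ ψ → t ≡ t′ × (∀ x → φ x ≡ ψ x)
    multiple-of-X-injective {t} {t′} {φ} {ψ} eq = t≡t′ , φ≗ψ
      where
      parts = Vecₚ.∷ʳ-injective (tabulate (λ x → toℕ (φ x) ⊖ T)) (tabulate (λ x → toℕ (ψ x) ⊖ T)) (Vecₚ.∷-injectiveʳ eq)
      t≡t′ : t ≡ t′
      t≡t′ = Finₚ.toℕ-injective (ℕₚ.suc-injective (ℤₚ.+-injective (proj₂ parts)))
      φ≗ψ : ∀ x → φ x ≡ ψ x
      φ≗ψ x = Finₚ.toℕ-injective (⊖-injectiveˡ T (begin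
        toℕ (φ x) ⊖ T                                       ≡⟨ Vecₚ.lookup∘tabulate (λ x → toℕ (φ x) ⊖ T) x ⟨
        lookup (tabulate (λ x → toℕ (φ x) ⊖ T)) x           ≡⟨ cong (λ v → lookup v x) (proj₁ parts) ⟩
        lookup (tabulate (λ x → toℕ (ψ x) ⊖ T)) x           ≡⟨ Vecₚ.lookup∘tabulate (λ x → toℕ (ψ x) ⊖ T) x ⟩
        toℕ (ψ x) ⊖ T                                       ∎))
        where open ≡-Reasoning

    multiple-of-X-InRℕ : ∀ t φ → InRℕ n T (multiple-of-X t φ)
    multiple-of-X-InRℕ t φ = lead≢0 , Allₚ.lookup⁺ heights , q , cofactor t φ , factorisation
      where
      lead≢0 : lookup (multiple-of-X t φ) (fromℕ n) ≢ 0ℤ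
      lead≢0 eq with trans (sym (lookup-∷ʳ-fromℕ (tabulate (λ x → toℕ (φ x) ⊖ T)) (+ suc (toℕ t)))) eq
      ... | ()
      heights : All (λ z → ∣ z ∣ ≤ T) (multiple-of-X t φ)
      heights = z≤n ∷ All-∷ʳ (Allₚ.tabulate⁺ {f = λ x → toℕ (φ x) ⊖ T} (λ x → ∣⊖∣≤ T (ℕₚ.≤-pred (Finₚ.toℕ<n (φ x)))))
                             (Finₚ.toℕ<n t)
      q : Vec ℤ n
      q = 0ℤ ∷ 1ℤ ∷ replicate (suc j) 0ℤ
      q≈X : toList q ≈ linear 0ℤ 1ℤ
      q≈X zero          = refl
      q≈X (suc zero)    = refl
      q≈X (suc (suc i)) = coeff-replicate-0 (suc j) i
      factorisation : ∀ k → mulCoeff (toList q) (toList (cofactor t φ)) k ≡ coeff (toList (multiple-of-X t φ)) k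
      factorisation k = begin
        mulCoeff (toList q) w k        ≡⟨ coeff-⊛ (toList q) w k ⟨
        coeff (toList q ⊛ w) k         ≡⟨ ⊛-cong (toList q) (linear 0ℤ 1ℤ) w w q≈X (λ _ → refl) k ⟩
        coeff (linear 0ℤ 1ℤ ⊛ w) k     ≡⟨ X⊛ w k ⟩
        coeff (0ℤ ∷ w) k               ∎
        where
        open ≡-Reasoning
        w = toList (cofactor t φ)

  lower-bound : ∀ j T → 1 ≤ T → Σ ℕ λ k → suc T ^ (3 + j) ≤ k ×
    Σ (Fin k → Vec ℤ (suc (3 + j))) λ f → Injective _≡_ _≡_ f × (∀ i → InRℕ (3 + j) T (f i))
  lower-bound j T 1≤T = T * B ^ (2 + j) , lower-count j T 1≤T , family , family-injective , λ i → multiple-of-X-InRℕ j T (t-of i) (φ-of i)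
    where
    B : ℕ
    B = suc (T + T)
    t-of : Fin (T * B ^ (2 + j)) → Fin T
    t-of i = proj₁ (remQuot {T} (B ^ (2 + j)) i)
    φ-of : Fin (T * B ^ (2 + j)) → Fin (2 + j) → Fin B
    φ-of i = finToFun (proj₂ (remQuot {T} (B ^ (2 + j)) i))
    family : Fin (T * B ^ (2 + j)) → Vec ℤ (suc (3 + j))
    family i = multiple-of-X j T (t-of i) (φ-of i)
    family-injective : Injective _≡_ _≡_ family
    family-injective {i} {i′} eq = begin
      i                               ≡⟨ Finₚ.combine-remQuot {T} (B ^ (2 + j)) i ⟨
      combine t r                     ≡⟨ cong₂ combine t≡t′ r≡r′ ⟩
      combine t′ r′                   ≡⟨ Finₚ.combine-remQuot {T} (B ^ (2 + j)) i′ ⟩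
      i′                              ∎
      where
      open ≡-Reasoning
      t = t-of i
      r = proj₂ (remQuot {T} (B ^ (2 + j)) i)
      t′ = t-of i′
      r′ = proj₂ (remQuot {T} (B ^ (2 + j)) i′)
      same = multiple-of-X-injective j T {t-of i} {t-of i′} {φ-of i} {φ-of i′} eq
      t≡t′ = proj₁ same
      r≡r′ : r ≡ r′
      r≡r′ = trans (sym (Finₚ.funToFin-finToFin {2 + j} {B} r))
                   (trans (funToFin-cong (proj₂ same)) (Finₚ.funToFin-finToFin {2 + j} {B} r′))

open LowerBound

-- ℚ's multiplication is needed only in the statement; above, _*_ is that of ℕ or ℤ.
open import Data.Rational using (_*_)

theorem1 : (n : ℕ) → 3 ≤ n →
    Σ ℚ λ C → (0ℚ <ℚ C) × ((t : ℚ) → 1ℚ ≤ℚ t →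
      (Σ ℕ λ k → (t ^ℚ n ≤ℚ ℕ→ℚ k) ×
        Σ (Fin k → Vec ℤ (suc n)) λ f → Injective _≡_ _≡_ f × ((i : Fin k) → InR n t (f i)))
      × ((m : ℕ) (f : Fin m → Vec ℤ (suc n)) → Injective _≡_ _≡_ f →
          ((i : Fin m) → InR n t (f i)) → ℕ→ℚ m ≤ℚ C * (t ^ℚ n)))
theorem1 n@(suc (suc (suc j))) (s≤s (s≤s (s≤s z≤n))) = ℕ→ℚ C , ℕ→ℚ-pos C , λ t 1≤t →
  let 0≤t = ℚₚ.≤-trans (ℕ→ℚ-nonNeg 1) 1≤t
      1≤T = ℕ→ℚ≤⇒≤floorℕ 1≤t
      k , count , f , f-injective , inR = lower-bound j (floorℕ t) 1≤T
  in (k , ^ℚ≤ℕ→ℚ n 0≤t count , f , f-injective , λ i → InRℕ⇒InR (f i) 0≤t (inR i)) ,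
     λ m f f-injective inR → ℕ→ℚ≤*^ℚ C n 0≤t
       (ℕₚ.≤-trans (upper-bound j (floorℕ t) 1≤T f f-injective (λ i → InR⇒InRℕ (f i) (inR i)))
                   (ℕₚ.*-monoʳ-≤ (floorℕ t ℕ.^ n) (ℕₚ.n≤1+n (upper-constant j))))
  where
  C = suc (upper-constant j)
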